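{- Assume the setup described in the context. With probability at least $99/100$, $\delta_{\{1\}}(G[D_1])+\delta_{\{2\}}(G[D_1])\ge(1+\tfrac{\varepsilon}{2})\tfrac{|D_1|}{2}$.
   Context: Constants satisfy $1/n\ll1/C'\ll1/C\ll\varepsilon$ with $n,C\in\mathbb{N}$, where $x\ll y$ means that for any $y>0$ there is $x_0>0$ such that for all $x<x_0$ the statement holds. For a bipartite graph with parts $V_1,V_2$ and $X\subseteq V(G)$, $\delta_{\{1\}}(G[X])$ is the minimum degree in $G[X]$ of a vertex of $X\cap V_1$ and $\delta_{\{2\}}(G[X])$ that of a vertex of $X\cap V_2$. Setup: $G$ is a bipartite graph with parts $V_1=\{v_1,\dots,v_n\}$, $V_2=\{u_1,\dots,u_n\}$ and $\delta_{\{1\}}(G)+\delta_{\{2\}}(G)\ge(1+\varepsilon)n$. Let $r=(C-1)C+(n\bmod (C-1)C)$ and $W_1^1=W_1^2=[r]$. Let $\pi_1,\pi_2$ be independent uniformly random permutations of $[n]$ and $D_1=\{v_j:\pi_1(j)\in W_1^1\}\cup\{u_j:\pi_2(j)\in W_1^2\}$.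
   Formalization: The constant ε ranges only over the positive rationals. -}

module Defs where

open import Data.Bool using (Bool; true; false; _∧_; if_then_else_; T)
open import Data.Nat as ℕ using (ℕ; zero; suc; _*_; _∸_; _⊓_; _<ᵇ_)
open import Data.Nat.DivMod using (_%_)
open import Data.Fin using (Fin; toℕ)
import Data.Fin.Properties as FinP
open import Data.List using (List; []; _∷_; map; concatMap; filter; length; sum; allFin; filterᵇ; cartesianProduct)
open import Data.Vec using (Vec; []; _∷_; lookup; toList)
open import Data.Product using (_×_; _,_)
open import Data.Rational as ℚ using (ℚ; _/_)
open import Data.Integer using (+_)
open import Relation.Nullary using (Dec)
import Data.List.Relation.Unary.Unique.DecPropositional as UniqueDec

-- A bipartite graph with parts V₁ = {v_0..v_{n-1}}, V₂ = {u_0..u_{n-1}}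
-- (0-indexed), given by its bipartite adjacency: G i j = true iff v_i u_j ∈ E.
BipGraph : ℕ → Set
BipGraph n = Fin n → Fin n → Bool

-- A vertex subset X, given by its characteristic functions on V₁ and V₂.
Subset2 : ℕ → Set
Subset2 n = (Fin n → Bool) × (Fin n → Bool)

full : ∀ {n} → Subset2 n
full = (λ _ → true) , (λ _ → true)

count : ∀ {n} → (Fin n → Bool) → ℕ
count {n} p = length (filterᵇ p (allFin n))

size : ∀ {n} → Subset2 n → ℕ
size (S₁ , S₂) = count S₁ ℕ.+ count S₂

-- minimum of a list of naturals (the empty minimum is taken to be 0;
-- it never occurs in the statement for large n)
minList : List ℕ → ℕ
minList []       = 0
minList (x ∷ []) = x
minList (x ∷ xs@(_ ∷ _)) = x ⊓ minList xs

δ₁ : ∀ {n} → BipGraph n → Subset2 n → ℕ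
δ₁ {n} G (S₁ , S₂) =
  minList (map (λ i → count (λ j → S₂ j ∧ G i j)) (filterᵇ S₁ (allFin n)))

δ₂ : ∀ {n} → BipGraph n → Subset2 n → ℕ
δ₂ {n} G (S₁ , S₂) =
  minList (map (λ j → count (λ i → S₁ i ∧ G i j)) (filterᵇ S₂ (allFin n)))

allVecs : (k n : ℕ) → List (Vec (Fin n) k)
allVecs zero    n = [] ∷ []
allVecs (suc k) n = concatMap (λ x → map (x ∷_) (allVecs k n)) (allFin n)

-- all permutations of [n], as the list of their value tables (π(0),…,π(n-1))
perms : (n : ℕ) → List (Vec (Fin n) n)
perms n = filter (λ v → UniqueDec.unique? FinP._≟_ (toList v)) (allVecs n n)

-- r = (C-1)C + (n mod (C-1)C)   (for C ≥ 2, so the modulus is nonzero)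
rVal : (C n : ℕ) → ℕ
rVal zero n = 0
rVal (suc zero) n = 0
rVal C@(suc (suc c)) n = (C ∸ 1) * C ℕ.+ (n % ((C ∸ 1) * C))

-- D₁ = {v_j : π₁(j) ∈ [r]} ∪ {u_j : π₂(j) ∈ [r]}; with 0-indexing,
-- π(j) ∈ [r] = {1,…,r} becomes toℕ (π j) < r.
D₁ : ∀ {n} → ℕ → Vec (Fin n) n → Vec (Fin n) n → Subset2 n
D₁ r π₁ π₂ = (λ j → toℕ (lookup π₁ j) <ᵇ r) , (λ j → toℕ (lookup π₂ j) <ᵇ r)

ℕ→ℚ : ℕ → ℚ
ℕ→ℚ k = + k / 1

Good : ∀ {n} → BipGraph n → ℚ → ℕ → Vec (Fin n) n × Vec (Fin n) n → Set
Good G ε r (π₁ , π₂) =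
  let D = D₁ r π₁ π₂ in
  (ℚ.1ℚ ℚ.+ ε ℚ.* ℚ.½) ℚ.* (ℕ→ℚ (size D) ℚ.* ℚ.½) ℚ.≤ ℕ→ℚ (δ₁ G D ℕ.+ δ₂ G D)

good? : ∀ {n} (G : BipGraph n) (ε : ℚ) (r : ℕ) → (p : Vec (Fin n) n × Vec (Fin n) n) → Dec (Good G ε r p)
good? G ε r (π₁ , π₂) =
  let D = D₁ r π₁ π₂ in
  (ℚ.1ℚ ℚ.+ ε ℚ.* ℚ.½) ℚ.* (ℕ→ℚ (size D) ℚ.* ℚ.½) ℚ.≤? ℕ→ℚ (δ₁ G D ℕ.+ δ₂ G D)

-- number of pairs (π₁, π₂) of permutations for which Good holds
-- (π₁, π₂ independent uniform ⇒ probability = goodCount / |perms n|²)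
goodCount : ∀ {n} → BipGraph n → ℚ → ℕ → ℕ
goodCount {n} G ε r = length (filter (good? G ε r) (cartesianProduct (perms n) (perms n)))

module Submission where

-- Write ε = p/q. A vertex of V₁ of degree d has on average dr/n neighbours in D₁ ∩ V₂. If no vertex of D₁
-- falls short of this mean by more than εr/4, then δ₁(G[D₁]) + δ₂(G[D₁]) ≥ (δ₁(G) + δ₂(G)) r/n − εr/2
-- ≥ (1 + ε/2) r = (1 + ε/2)|D₁|/2.
-- D₁ ∩ V₂ is the set of the first r entries of the inverse of π₂. Summing a weight of these entries over all
-- permutations gives at most (n − r)! times its sum over all n^r sequences, i.e. over r independent uniform
-- draws, and n^r ≤ 2 (n)_r once 2r² ≤ n. For independent draws the fourth central moment of n times the number
-- of neighbours is at most 3r²n⁴, so by Markov's inequality a fixed vertex falls short with probability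
-- O(q⁴/(p⁴r²)). A union bound over the 2r vertices of D₁ makes the failure probability O(q⁴/r) ≤ 1/100
-- once r ≥ C ≥ 1200 (4q)⁴.

open import Algebra.Bundles using (CommutativeSemiring)
open import Data.Bool using (Bool; true; false; T; _∧_)
open import Data.Bool.Properties using (∧-identityʳ)
open import Data.Empty using (⊥-elim)
open import Data.Fin using (Fin; toℕ; punchOut) renaming (zero to fzero; suc to fsuc)
import Data.Fin.Properties as Fin
open import Data.Integer as ℤ using (ℤ)
import Data.Integer.Properties as ℤ
import Data.Integer.Tactic.RingSolver as ℤ
open import Data.List as List using (List; []; _∷_; [_]; _++_; map; concatMap; cartesianProduct; filter; filterᵇ; length; allFin)
open import Data.List.Membership.Propositional using (_∈_)
open import Data.List.Membership.Propositional.Properties using (∈-allFin; ∈-filter⁻)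
open import Data.List.Properties using (++-assoc; ++-identityʳ; length-++; length-map; map-tabulate; length-tabulate; filter-all)
open import Data.List.Relation.Unary.All as All using (All; []; _∷_)
import Data.List.Relation.Unary.All.Properties as All
open import Data.List.Relation.Unary.AllPairs using ([]; _∷_)
open import Data.List.Relation.Unary.Any using (here; there)
import Data.List.Relation.Unary.Unique.DecPropositional as UniqueDec
open import Data.List.Relation.Unary.Unique.Propositional using (Unique)
import Data.List.Relation.Unary.Unique.Propositional.Properties as Unique
open import Data.Nat as ℕ using (ℕ; zero; suc)
open import Data.Nat.Coprimality as Coprime using (Coprime)
open import Data.Nat.DivMod using (_%_; m%n<n)
import Data.Nat.Properties as ℕ
open import Data.Product using (Σ; _×_; _,_; ∃; proj₁; proj₂)
open import Data.Rational as ℚ using (ℚ; mkℚ; toℚᵘ)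
import Data.Rational.Properties as ℚ
open import Data.Rational.Unnormalised as ℚᵘ using (ℚᵘ; mkℚᵘ; *≤*)
import Data.Rational.Unnormalised.Properties as ℚᵘ
open import Data.Sum using (inj₁; inj₂)
open import Data.Unit using (tt)
open import Data.Vec using (Vec; []; _∷_; lookup; toList; tabulate)
import Data.Vec.Properties as Vec
open import Function using (_∘_; id)
open import Function.Bundles using (mk⇔)
open import Function.Definitions using (Injective)
open import Level using (0ℓ)
open import Relation.Binary.Definitions using (DecidableEquality)
import Relation.Binary.PropositionalEquality as ≡
open import Relation.Nullary using (¬_; Dec; yes; no; does)
open import Relation.Nullary.Decidable using (T?; does-⇔; dec-true; dec-false)
open import Relation.Unary using (Pred; Decidable)
open import Defs

-- Sums over lists

module ListSum {c ℓ} (R : CommutativeSemiring c ℓ) where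

  open CommutativeSemiring R
  open import Algebra.Properties.CommutativeSemigroup +-commutativeSemigroup using (interchange)
  open import Relation.Binary.Reasoning.Setoid setoid

  private variable A B : Set

  ∑ : List A → (A → Carrier) → Carrier
  ∑ []       f = 0#
  ∑ (x ∷ xs) f = f x + ∑ xs f

  ∑-cong-∈ : (xs : List A) {f g : A → Carrier} → (∀ x → x ∈ xs → f x ≈ g x) → ∑ xs f ≈ ∑ xs g
  ∑-cong-∈ []       f≈g = refl
  ∑-cong-∈ (x ∷ xs) f≈g = +-cong (f≈g x (here ≡.refl)) (∑-cong-∈ xs (λ y → f≈g y ∘ there))

  ∑-cong : (xs : List A) {f g : A → Carrier} → (∀ x → f x ≈ g x) → ∑ xs f ≈ ∑ xs g
  ∑-cong xs f≈g = ∑-cong-∈ xs (λ x _ → f≈g x)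

  ∑-++ : (xs ys : List A) (f : A → Carrier) → ∑ (xs ++ ys) f ≈ ∑ xs f + ∑ ys f
  ∑-++ []       ys f = sym (+-identityˡ _)
  ∑-++ (x ∷ xs) ys f = trans (+-congˡ (∑-++ xs ys f)) (sym (+-assoc _ _ _))

  ∑-0 : (xs : List A) → ∑ xs (λ _ → 0#) ≈ 0#
  ∑-0 []       = refl
  ∑-0 (x ∷ xs) = trans (+-identityˡ _) (∑-0 xs)

  ∑-+ : (xs : List A) (f g : A → Carrier) → ∑ xs (λ x → f x + g x) ≈ ∑ xs f + ∑ xs g
  ∑-+ []       f g = sym (+-identityˡ 0#)
  ∑-+ (x ∷ xs) f g = trans (+-congˡ (∑-+ xs f g)) (interchange _ _ _ _)

  ∑-*ˡ : (xs : List A) (a : Carrier) (f : A → Carrier) → ∑ xs (λ x → a * f x) ≈ a * ∑ xs f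
  ∑-*ˡ []       a f = sym (zeroʳ a)
  ∑-*ˡ (x ∷ xs) a f = trans (+-congˡ (∑-*ˡ xs a f)) (sym (distribˡ a _ _))

  ∑-*ʳ : (xs : List A) (a : Carrier) (f : A → Carrier) → ∑ xs (λ x → f x * a) ≈ ∑ xs f * a
  ∑-*ʳ xs a f = begin
    ∑ xs (λ x → f x * a) ≈⟨ ∑-cong xs (λ x → *-comm (f x) a) ⟩
    ∑ xs (λ x → a * f x) ≈⟨ ∑-*ˡ xs a f ⟩
    a * ∑ xs f          ≈⟨ *-comm a _ ⟩
    ∑ xs f * a          ∎

  ∑-map : (g : A → B) (xs : List A) (f : B → Carrier) → ∑ (map g xs) f ≈ ∑ xs (f ∘ g)
  ∑-map g []       f = refl
  ∑-map g (x ∷ xs) f = +-congˡ (∑-map g xs f)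

  ∑-concatMap : (g : A → List B) (xs : List A) (f : B → Carrier) →
                ∑ (concatMap g xs) f ≈ ∑ xs (λ x → ∑ (g x) f)
  ∑-concatMap g []       f = refl
  ∑-concatMap g (x ∷ xs) f = trans (∑-++ (g x) (concatMap g xs) f) (+-congˡ (∑-concatMap g xs f))

  ∑-cartesianProduct : (xs : List A) (ys : List B) (f : A × B → Carrier) →
                       ∑ (cartesianProduct xs ys) f ≈ ∑ xs (λ x → ∑ ys (λ y → f (x , y)))
  ∑-cartesianProduct []       ys f = refl
  ∑-cartesianProduct (x ∷ xs) ys f =
    trans (∑-++ (map (x ,_) ys) _ f) (+-cong (∑-map (x ,_) ys f) (∑-cartesianProduct xs ys f))

  ∑-allVecs-suc : (k n : ℕ) (f : Vec (Fin n) (suc k) → Carrier) →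
                  ∑ (allVecs (suc k) n) f ≈ ∑ (allFin n) (λ x → ∑ (allVecs k n) (λ w → f (x ∷ w)))
  ∑-allVecs-suc k n f = trans (∑-concatMap (λ x → map (x ∷_) (allVecs k n)) (allFin n) f)
                              (∑-cong (allFin n) (λ x → ∑-map (x ∷_) (allVecs k n) f))

  ∑-swap : (xs : List A) (ys : List B) (f : A → B → Carrier) →
           ∑ xs (λ x → ∑ ys (f x)) ≈ ∑ ys (λ y → ∑ xs (λ x → f x y))
  ∑-swap []       ys f = sym (∑-0 ys)
  ∑-swap (x ∷ xs) ys f = begin
    ∑ ys (f x) + ∑ xs (λ x → ∑ ys (f x))               ≈⟨ +-congˡ (∑-swap xs ys f) ⟩
    ∑ ys (f x) + ∑ ys (λ y → ∑ xs (λ x → f x y))       ≈⟨ ∑-+ ys (f x) _ ⟨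
    ∑ ys (λ y → f x y + ∑ xs (λ x → f x y))            ∎

  ∑∑-* : (xs : List A) (ys : List B) (f : A → Carrier) (g : B → Carrier) →
         ∑ xs (λ x → ∑ ys (λ y → f x * g y)) ≈ ∑ xs f * ∑ ys g
  ∑∑-* xs ys f g = trans (∑-cong xs (λ x → ∑-*ˡ ys (f x) g)) (∑-*ʳ xs (∑ ys g) f)

  ∑∑-*-+ : (xs : List A) (ys : List B) (f : A → Carrier) (g : B → Carrier) (h : A → B → Carrier) →
           ∑ xs (λ x → ∑ ys (λ y → f x * g y + h x y)) ≈ ∑ xs f * ∑ ys g + ∑ xs (λ x → ∑ ys (h x))
  ∑∑-*-+ xs ys f g h = begin
    ∑ xs (λ x → ∑ ys (λ y → f x * g y + h x y))                       ≈⟨ ∑-cong xs (λ x → ∑-+ ys _ (h x)) ⟩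
    ∑ xs (λ x → ∑ ys (λ y → f x * g y) + ∑ ys (h x))                  ≈⟨ ∑-+ xs _ _ ⟩
    ∑ xs (λ x → ∑ ys (λ y → f x * g y)) + ∑ xs (λ x → ∑ ys (h x))     ≈⟨ +-congʳ (∑∑-* xs ys f g) ⟩
    ∑ xs f * ∑ ys g + ∑ xs (λ x → ∑ ys (h x))                         ∎

open ListSum ℕ.+-*-commutativeSemiring

module ℤ∑ = ListSum ℤ.+-*-commutativeSemiring
open ℤ∑ using () renaming (∑ to ∑ℤ)

-- Moments of a sum of two independent centred variables

module CentredMoments where

  open import Data.Integer using (ℤ; +_; -[1+_]; ∣_∣; 0ℤ; 1ℤ; _+_; _*_; _^_; -_)
  open import Data.Integer.Tactic.RingSolver using (solve-∀)
  open import Relation.Binary.PropositionalEquality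

  private variable A B : Set

  ∑ℤ-pos : (xs : List A) (f : A → ℕ) → ∑ℤ xs (λ x → + f x) ≡ + ∑ xs f
  ∑ℤ-pos []       f = refl
  ∑ℤ-pos (x ∷ xs) f = trans (cong (λ s → + f x + s) (∑ℤ-pos xs f)) (sym (ℤ.pos-+ (f x) _))

  ∑ℤ-1 : (xs : List A) → ∑ℤ xs (λ _ → 1ℤ) ≡ + length xs
  ∑ℤ-1 []       = refl
  ∑ℤ-1 (x ∷ xs) = trans (cong (λ s → 1ℤ + s) (∑ℤ-1 xs)) (sym (ℤ.pos-+ 1 (length xs)))

  ∑ℤ-const : (xs : List A) (c : ℤ) → ∑ℤ xs (λ _ → c) ≡ + length xs * c
  ∑ℤ-const xs c = begin
    ∑ℤ xs (λ _ → c)           ≡⟨ ℤ∑.∑-cong xs (λ _ → ℤ.*-identityˡ c) ⟨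
    ∑ℤ xs (λ _ → 1ℤ * c)      ≡⟨ ℤ∑.∑-*ʳ xs c (λ _ → 1ℤ) ⟩
    ∑ℤ xs (λ _ → 1ℤ) * c      ≡⟨ cong (_* c) (∑ℤ-1 xs) ⟩
    + length xs * c           ∎
    where open ≡-Reasoning

  pos-^ : ∀ m k → + (m ℕ.^ k) ≡ (+ m) ^ k
  pos-^ m zero    = refl
  pos-^ m (suc k) = trans (ℤ.pos-* m (m ℕ.^ k)) (cong (λ i → + m * i) (pos-^ m k))

  pos-∣∣^even : ∀ k → (∀ i → (- i) ^ k ≡ i ^ k) → ∀ i → + (∣ i ∣ ℕ.^ k) ≡ i ^ k
  pos-∣∣^even k even (+ m)     = pos-^ m k
  pos-∣∣^even k even -[1+ m ] = trans (pos-^ (suc m) k) (sym (even (+ suc m)))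

  -- The ring solver does not see through _^_, so the identities it proves spell powers out as products.
  pos-∑∣∣^2 : (xs : List A) (f : A → ℤ) → + ∑ xs (λ x → ∣ f x ∣ ℕ.^ 2) ≡ ∑ℤ xs (λ x → f x ^ 2)
  pos-∑∣∣^2 xs f = trans (sym (∑ℤ-pos xs _)) (ℤ∑.∑-cong xs (λ x → pos-∣∣^even 2 neg-square (f x)))
    where
    neg-square : ∀ i → (- i) * ((- i) * 1ℤ) ≡ i * (i * 1ℤ)
    neg-square = solve-∀

  pos-∑∣∣^4 : (xs : List A) (f : A → ℤ) → + ∑ xs (λ x → ∣ f x ∣ ℕ.^ 4) ≡ ∑ℤ xs (λ x → f x ^ 4)
  pos-∑∣∣^4 xs f = trans (sym (∑ℤ-pos xs _)) (ℤ∑.∑-cong xs (λ x → pos-∣∣^even 4 neg-fourth (f x)))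
    where
    neg-fourth : ∀ i → (- i) * ((- i) * ((- i) * ((- i) * 1ℤ))) ≡ i * (i * (i * (i * 1ℤ)))
    neg-fourth = solve-∀

  module _ (as : List A) (bs : List B) (Y : A → ℤ) (X : B → ℤ) (∑Y≡0 : ∑ℤ as Y ≡ 0ℤ) where

    open ≡-Reasoning

    private
      ∑Y^ ∑X^ : ℕ → ℤ
      ∑Y^ k = ∑ℤ as (λ a → Y a ^ k)
      ∑X^ k = ∑ℤ bs (λ b → X b ^ k)
      ∑1ᵃ ∑1ᵇ : ℤ
      ∑1ᵃ = ∑ℤ as (λ _ → 1ℤ)
      ∑1ᵇ = ∑ℤ bs (λ _ → 1ℤ)

    ∑∑-+-^2 : ∑ℤ as (λ a → ∑ℤ bs (λ b → (Y a + X b) ^ 2)) ≡ + length bs * ∑Y^ 2 + + length as * ∑X^ 2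
    ∑∑-+-^2 = begin
      ∑ℤ as (λ a → ∑ℤ bs (λ b → (Y a + X b) ^ 2))
        ≡⟨ ℤ∑.∑-cong as (λ a → ℤ∑.∑-cong bs (λ b → expand (Y a) (X b))) ⟩
      ∑ℤ as (λ a → ∑ℤ bs (λ b → Y a ^ 2 * 1ℤ + ((+ 2 * Y a) * X b + 1ℤ * X b ^ 2)))
        ≡⟨ ℤ∑.∑∑-*-+ as bs _ _ _ ⟩
      ∑Y^ 2 * ∑1ᵇ + ∑ℤ as (λ a → ∑ℤ bs (λ b → (+ 2 * Y a) * X b + 1ℤ * X b ^ 2))
        ≡⟨ cong (λ s → ∑Y^ 2 * ∑1ᵇ + s) (trans (ℤ∑.∑∑-*-+ as bs _ _ _) (cong (λ s → ∑ℤ as (λ a → + 2 * Y a) * ∑ℤ bs X + s) (ℤ∑.∑∑-* as bs _ _))) ⟩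
      ∑Y^ 2 * ∑1ᵇ + (∑ℤ as (λ a → + 2 * Y a) * ∑ℤ bs X + ∑1ᵃ * ∑X^ 2)
        ≡⟨ cong₂ (λ u v → ∑Y^ 2 * u + (v * ∑ℤ bs X + ∑1ᵃ * ∑X^ 2)) (∑ℤ-1 bs) (trans (ℤ∑.∑-*ˡ as (+ 2) Y) (cong (+ 2 *_) ∑Y≡0)) ⟩
      ∑Y^ 2 * + length bs + ((+ 2 * 0ℤ) * ∑ℤ bs X + ∑1ᵃ * ∑X^ 2)
        ≡⟨ cong (λ u → ∑Y^ 2 * + length bs + ((+ 2 * 0ℤ) * ∑ℤ bs X + u * ∑X^ 2)) (∑ℤ-1 as) ⟩
      ∑Y^ 2 * + length bs + ((+ 2 * 0ℤ) * ∑ℤ bs X + + length as * ∑X^ 2)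
        ≡⟨ tidy (∑Y^ 2) (+ length bs) (∑ℤ bs X) (+ length as) (∑X^ 2) ⟩
      + length bs * ∑Y^ 2 + + length as * ∑X^ 2 ∎
      where
      expand : ∀ y x → (y + x) * ((y + x) * 1ℤ) ≡ y * (y * 1ℤ) * 1ℤ + ((+ 2 * y) * x + 1ℤ * (x * (x * 1ℤ)))
      expand = solve-∀
      tidy : ∀ s lb sx la t → s * lb + ((+ 2 * 0ℤ) * sx + la * t) ≡ lb * s + la * t
      tidy = solve-∀

    ∑∑-+-^4 : ∑ℤ bs X ≡ 0ℤ →
              ∑ℤ as (λ a → ∑ℤ bs (λ b → (Y a + X b) ^ 4))
              ≡ + length bs * ∑Y^ 4 + + 6 * ∑Y^ 2 * ∑X^ 2 + + length as * ∑X^ 4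
    ∑∑-+-^4 ∑X≡0 = begin
      ∑ℤ as (λ a → ∑ℤ bs (λ b → (Y a + X b) ^ 4))
        ≡⟨ ℤ∑.∑-cong as (λ a → ℤ∑.∑-cong bs (λ b → expand (Y a) (X b))) ⟩
      ∑ℤ as (λ a → ∑ℤ bs (λ b → Y a ^ 4 * 1ℤ + (+ 4 * Y a ^ 3 * X b + (+ 6 * Y a ^ 2 * X b ^ 2 + (+ 4 * Y a * X b ^ 3 + 1ℤ * X b ^ 4)))))
        ≡⟨ trans (ℤ∑.∑∑-*-+ as bs (λ a → Y a ^ 4) (λ _ → 1ℤ) _) (cong (λ s → ∑Y^ 4 * ∑1ᵇ + s)
           (trans (ℤ∑.∑∑-*-+ as bs (λ a → + 4 * Y a ^ 3) X _) (cong (λ s → ∑ℤ as (λ a → + 4 * Y a ^ 3) * ∑ℤ bs X + s)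
           (trans (ℤ∑.∑∑-*-+ as bs (λ a → + 6 * Y a ^ 2) (λ b → X b ^ 2) _) (cong (λ s → ∑ℤ as (λ a → + 6 * Y a ^ 2) * ∑X^ 2 + s)
           (trans (ℤ∑.∑∑-*-+ as bs (λ a → + 4 * Y a) (λ b → X b ^ 3) _) (cong (λ s → ∑ℤ as (λ a → + 4 * Y a) * ∑X^ 3 + s)
           (ℤ∑.∑∑-* as bs (λ _ → 1ℤ) (λ b → X b ^ 4))))))))) ⟩
      ∑Y^ 4 * ∑1ᵇ + (∑ℤ as (λ a → + 4 * Y a ^ 3) * ∑ℤ bs X + (∑ℤ as (λ a → + 6 * Y a ^ 2) * ∑X^ 2
        + (∑ℤ as (λ a → + 4 * Y a) * ∑X^ 3 + ∑1ᵃ * ∑X^ 4)))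
        ≡⟨ cong₂ (λ u v → ∑Y^ 4 * u + (∑ℤ as (λ a → + 4 * Y a ^ 3) * ∑ℤ bs X + (∑ℤ as (λ a → + 6 * Y a ^ 2) * ∑X^ 2 + v)))
                 (∑ℤ-1 bs) (cong₂ (λ u v → u * ∑X^ 3 + v * ∑X^ 4) (trans (ℤ∑.∑-*ˡ as (+ 4) Y) (cong (λ s → + 4 * s) ∑Y≡0)) (∑ℤ-1 as)) ⟩
      ∑Y^ 4 * + length bs + (∑ℤ as (λ a → + 4 * Y a ^ 3) * ∑ℤ bs X + (∑ℤ as (λ a → + 6 * Y a ^ 2) * ∑X^ 2
        + (+ 4 * 0ℤ * ∑X^ 3 + + length as * ∑X^ 4)))
        ≡⟨ cong₂ (λ u v → ∑Y^ 4 * + length bs + (∑ℤ as (λ a → + 4 * Y a ^ 3) * u + (v * ∑X^ 2 + (+ 4 * 0ℤ * ∑X^ 3 + + length as * ∑X^ 4))))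
                 ∑X≡0 (ℤ∑.∑-*ˡ as (+ 6) (λ a → Y a ^ 2)) ⟩
      ∑Y^ 4 * + length bs + (∑ℤ as (λ a → + 4 * Y a ^ 3) * 0ℤ + (+ 6 * ∑Y^ 2 * ∑X^ 2
        + (+ 4 * 0ℤ * ∑X^ 3 + + length as * ∑X^ 4)))
        ≡⟨ tidy (∑Y^ 4) (+ length bs) (∑ℤ as (λ a → + 4 * Y a ^ 3)) (∑Y^ 2) (∑X^ 2) (∑X^ 3) (+ length as) (∑X^ 4) ⟩
      + length bs * ∑Y^ 4 + + 6 * ∑Y^ 2 * ∑X^ 2 + + length as * ∑X^ 4 ∎
      where
      expand : ∀ y x → (y + x) * ((y + x) * ((y + x) * ((y + x) * 1ℤ)))
                       ≡ y * (y * (y * (y * 1ℤ))) * 1ℤ + (+ 4 * (y * (y * (y * 1ℤ))) * x + (+ 6 * (y * (y * 1ℤ)) * (x * (x * 1ℤ))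
                         + (+ 4 * y * (x * (x * (x * 1ℤ))) + 1ℤ * (x * (x * (x * (x * 1ℤ)))))))
      expand = solve-∀
      tidy : ∀ s₄ lb c s₂ t₂ t₃ la t₄ → s₄ * lb + (c * 0ℤ + (+ 6 * s₂ * t₂ + (+ 4 * 0ℤ * t₃ + la * t₄)))
                                         ≡ lb * s₄ + + 6 * s₂ * t₂ + la * t₄
      tidy = solve-∀

    ∑∑-+ : ∑ℤ as (λ a → ∑ℤ bs (λ b → Y a + X b)) ≡ + length as * ∑ℤ bs X
    ∑∑-+ = begin
      ∑ℤ as (λ a → ∑ℤ bs (λ b → Y a + X b))
        ≡⟨ ℤ∑.∑-cong as (λ a → ℤ∑.∑-cong bs (λ b → cong₂ _+_ (sym (ℤ.*-identityʳ (Y a))) (sym (ℤ.*-identityˡ (X b))))) ⟩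
      ∑ℤ as (λ a → ∑ℤ bs (λ b → Y a * 1ℤ + 1ℤ * X b))
        ≡⟨ trans (ℤ∑.∑∑-*-+ as bs Y (λ _ → 1ℤ) _) (cong (λ s → ∑ℤ as Y * ∑ℤ bs (λ _ → 1ℤ) + s) (ℤ∑.∑∑-* as bs (λ _ → 1ℤ) X)) ⟩
      ∑ℤ as Y * ∑ℤ bs (λ _ → 1ℤ) + ∑ℤ as (λ _ → 1ℤ) * ∑ℤ bs X
        ≡⟨ cong₂ (λ u v → u * ∑ℤ bs (λ _ → 1ℤ) + v * ∑ℤ bs X) ∑Y≡0 (∑ℤ-1 as) ⟩
      0ℤ * ∑ℤ bs (λ _ → 1ℤ) + + length as * ∑ℤ bs X
        ≡⟨ ℤ.+-identityˡ _ ⟩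
      + length as * ∑ℤ bs X                           ∎

open CentredMoments

-- Imported only here because the modules above use these names for the operations of R and of ℤ.
open import Data.Nat using (_+_; _*_; _^_; _∸_; _⊔_; _≤_; _<_; _<ᵇ_; pred; z≤n; s≤s; NonZero; >-nonZero)
open import Data.Nat.Properties
open import Data.Nat.Tactic.RingSolver using (solve-∀)
open import Relation.Binary.PropositionalEquality hiding ([_])

𝟙 : Bool → ℕ
𝟙 true  = 1
𝟙 false = 0

𝟙≤1 : ∀ b → 𝟙 b ≤ 1
𝟙≤1 true  = s≤s z≤n
𝟙≤1 false = z≤n

𝟙-∧ : ∀ a b → 𝟙 (a ∧ b) ≡ 𝟙 a * 𝟙 b
𝟙-∧ true  b = sym (+-identityʳ _)
𝟙-∧ false b = refl

module _ {A : Set} where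

  ∑-mono-≤-∈ : (xs : List A) {f g : A → ℕ} → (∀ x → x ∈ xs → f x ≤ g x) → ∑ xs f ≤ ∑ xs g
  ∑-mono-≤-∈ []       f≤g = z≤n
  ∑-mono-≤-∈ (x ∷ xs) f≤g = +-mono-≤ (f≤g x (here refl)) (∑-mono-≤-∈ xs (λ y → f≤g y ∘ there))

  ∑-mono-≤ : (xs : List A) {f g : A → ℕ} → (∀ x → f x ≤ g x) → ∑ xs f ≤ ∑ xs g
  ∑-mono-≤ xs f≤g = ∑-mono-≤-∈ xs (λ x _ → f≤g x)

  ∑-const : (xs : List A) (a : ℕ) → ∑ xs (λ _ → a) ≡ length xs * a
  ∑-const []       a = refl
  ∑-const (x ∷ xs) a = cong (a +_) (∑-const xs a)

  length≡∑1 : (xs : List A) → length xs ≡ ∑ xs (λ _ → 1)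
  length≡∑1 xs = sym (trans (∑-const xs 1) (*-identityʳ _))

  ∑-filter : {P : Pred A 0ℓ} (P? : Decidable P) (xs : List A) (f : A → ℕ) →
             ∑ (filter P? xs) f ≡ ∑ xs (λ x → 𝟙 (does (P? x)) * f x)
  ∑-filter P? []       f = refl
  ∑-filter P? (x ∷ xs) f with does (P? x)
  ... | true  = cong₂ _+_ (sym (+-identityʳ (f x))) (∑-filter P? xs f)
  ... | false = ∑-filter P? xs f

  length-filter : {P : Pred A 0ℓ} (P? : Decidable P) (xs : List A) →
                  length (filter P? xs) ≡ ∑ xs (λ x → 𝟙 (does (P? x)))
  length-filter P? xs = begin
    length (filter P? xs)                   ≡⟨ length≡∑1 (filter P? xs) ⟩
    ∑ (filter P? xs) (λ _ → 1)              ≡⟨ ∑-filter P? xs (λ _ → 1) ⟩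
    ∑ xs (λ x → 𝟙 (does (P? x)) * 1)        ≡⟨ ∑-cong xs (λ x → *-identityʳ _) ⟩
    ∑ xs (λ x → 𝟙 (does (P? x)))            ∎
    where open ≡-Reasoning

  length-filterᵇ : (p : A → Bool) (xs : List A) → length (filterᵇ p xs) ≡ ∑ xs (𝟙 ∘ p)
  length-filterᵇ p xs = trans (length-filter (T? ∘ p) xs) (∑-cong xs (λ x → cong 𝟙 (does-T? (p x))))
    where
    does-T? : ∀ b → does (T? b) ≡ b
    does-T? true  = refl
    does-T? false = refl

  ∑≡0⇒≡0 : (xs : List A) (f : A → ℕ) → ∑ xs f ≡ 0 → ∀ {x} → x ∈ xs → f x ≡ 0
  ∑≡0⇒≡0 (y ∷ xs) f sum≡0 (here refl) = m+n≡0⇒m≡0 (f y) sum≡0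
  ∑≡0⇒≡0 (y ∷ xs) f sum≡0 (there x∈xs) = ∑≡0⇒≡0 xs f (m+n≡0⇒n≡0 (f y) sum≡0) x∈xs

record Enumerates {A : Set} (_≟_ : DecidableEquality A) (xs : List A) : Set where
  constructor occurring-once
  field occurs-once : ∀ z → ∑ xs (λ x → 𝟙 (does (x ≟ z))) ≡ 1

module _ {A : Set} {_≟_ : DecidableEquality A} {xs : List A} (enum : Enumerates _≟_ xs) where

  open Enumerates enum

  ∑-select : ∀ z (h : A → ℕ) → ∑ xs (λ x → 𝟙 (does (x ≟ z)) * h x) ≡ h z
  ∑-select z h = begin
    ∑ xs (λ x → 𝟙 (does (x ≟ z)) * h x) ≡⟨ ∑-cong xs at-z ⟩
    ∑ xs (λ x → 𝟙 (does (x ≟ z)) * h z) ≡⟨ ∑-*ʳ xs (h z) _ ⟩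
    ∑ xs (λ x → 𝟙 (does (x ≟ z))) * h z ≡⟨ cong (_* h z) (occurs-once z) ⟩
    1 * h z                              ≡⟨ *-identityˡ (h z) ⟩
    h z                                  ∎
    where
    open ≡-Reasoning
    at-z : ∀ x → 𝟙 (does (x ≟ z)) * h x ≡ 𝟙 (does (x ≟ z)) * h z
    at-z x with x ≟ z
    ... | yes refl = refl
    ... | no _     = refl

  ∑-reindex : (g g⁻¹ : A → A) → (∀ y → g⁻¹ (g y) ≡ y) → (∀ x → g (g⁻¹ x) ≡ x) →
              (h : A → ℕ) → ∑ xs (h ∘ g) ≡ ∑ xs h
  ∑-reindex g g⁻¹ g⁻¹∘g g∘g⁻¹ h = begin
    ∑ xs (h ∘ g)                                               ≡⟨ ∑-cong xs (λ y → ∑-select (g y) h) ⟨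
    ∑ xs (λ y → ∑ xs (λ x → 𝟙 (does (x ≟ g y)) * h x))         ≡⟨ ∑-swap xs xs _ ⟩
    ∑ xs (λ x → ∑ xs (λ y → 𝟙 (does (x ≟ g y)) * h x))         ≡⟨ ∑-cong xs (λ x → ∑-*ʳ xs (h x) _) ⟩
    ∑ xs (λ x → ∑ xs (λ y → 𝟙 (does (x ≟ g y))) * h x)         ≡⟨ ∑-cong xs (λ x → cong (_* h x) (trans (∑-cong xs (flip x)) (occurs-once (g⁻¹ x)))) ⟩
    ∑ xs (λ x → 1 * h x)                                       ≡⟨ ∑-cong xs (λ x → *-identityˡ (h x)) ⟩
    ∑ xs h                                                     ∎
    where
    open ≡-Reasoning
    flip : ∀ x y → 𝟙 (does (x ≟ g y)) ≡ 𝟙 (does (y ≟ g⁻¹ x))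
    flip x y with x ≟ g y | y ≟ g⁻¹ x
    ... | yes _    | yes _    = refl
    ... | no _     | no _     = refl
    ... | yes refl | no y≢    = ⊥-elim (y≢ (sym (g⁻¹∘g y)))
    ... | no x≢    | yes refl = ⊥-elim (x≢ (sym (g∘g⁻¹ x)))

∑-allFin-suc : (n : ℕ) (f : Fin (suc n) → ℕ) → ∑ (allFin (suc n)) f ≡ f fzero + ∑ (allFin n) (f ∘ fsuc)
∑-allFin-suc n f = cong (f fzero +_) (trans (cong (λ xs → ∑ xs f) (sym (map-tabulate id fsuc))) (∑-map fsuc (allFin n) f))

allFin-enumerates : (n : ℕ) → Enumerates Fin._≟_ (allFin n)
allFin-enumerates n = occurring-once (occurs-once n)
  where
  occurs-once : (n : ℕ) (z : Fin n) → ∑ (allFin n) (λ x → 𝟙 (does (x Fin.≟ z))) ≡ 1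
  occurs-once (suc n) z = trans (∑-allFin-suc n (λ x → 𝟙 (does (x Fin.≟ z)))) (at z)
    where
    at : ∀ z → 𝟙 (does (fzero Fin.≟ z)) + ∑ (allFin n) (λ x → 𝟙 (does (fsuc x Fin.≟ z))) ≡ 1
    at fzero    = cong suc (∑-0 (allFin n))
    at (fsuc z) = occurs-once n z

allVecs-enumerates : (k n : ℕ) → Enumerates (Vec.≡-dec Fin._≟_) (allVecs k n)
allVecs-enumerates k n = occurring-once (occurs-once k)
  where
  _≟ᵛ_ : ∀ {m} → DecidableEquality (Vec (Fin n) m)
  _≟ᵛ_ = Vec.≡-dec Fin._≟_
  open Enumerates (allFin-enumerates n) renaming (occurs-once to fin-occurs-once)
  occurs-once : ∀ k (v : Vec (Fin n) k) → ∑ (allVecs k n) (λ w → 𝟙 (does (w ≟ᵛ v))) ≡ 1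
  occurs-once zero    []      = refl
  occurs-once (suc k) (y ∷ v) = begin
    ∑ (allVecs (suc k) n) (λ w → 𝟙 (does (w ≟ᵛ (y ∷ v))))                             ≡⟨ ∑-allVecs-suc k n _ ⟩
    ∑ (allFin n) (λ x → ∑ (allVecs k n) (λ w → 𝟙 (does (x Fin.≟ y) ∧ does (w ≟ᵛ v)))) ≡⟨ ∑-cong (allFin n) split ⟩
    ∑ (allFin n) (λ x → 𝟙 (does (x Fin.≟ y)))                                        ≡⟨ fin-occurs-once y ⟩
    1                                                                                  ∎
    where
    open ≡-Reasoning
    split : ∀ x → ∑ (allVecs k n) (λ w → 𝟙 (does (x Fin.≟ y) ∧ does (w ≟ᵛ v))) ≡ 𝟙 (does (x Fin.≟ y))
    split x = begin
      ∑ (allVecs k n) (λ w → 𝟙 (does (x Fin.≟ y) ∧ does (w ≟ᵛ v)))       ≡⟨ ∑-cong (allVecs k n) (λ w → 𝟙-∧ (does (x Fin.≟ y)) (does (w ≟ᵛ v))) ⟩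
      ∑ (allVecs k n) (λ w → 𝟙 (does (x Fin.≟ y)) * 𝟙 (does (w ≟ᵛ v)))   ≡⟨ ∑-*ˡ (allVecs k n) (𝟙 (does (x Fin.≟ y))) (λ w → 𝟙 (does (w ≟ᵛ v))) ⟩
      𝟙 (does (x Fin.≟ y)) * ∑ (allVecs k n) (λ w → 𝟙 (does (w ≟ᵛ v)))   ≡⟨ cong (𝟙 (does (x Fin.≟ y)) *_) (occurs-once k v) ⟩
      𝟙 (does (x Fin.≟ y)) * 1                                             ≡⟨ *-identityʳ _ ⟩
      𝟙 (does (x Fin.≟ y))                                                 ∎

length-allFin : (n : ℕ) → length (allFin n) ≡ n
length-allFin n = length-tabulate {n = n} (λ (i : Fin n) → i)

length-allVecs : (k n : ℕ) → length (allVecs k n) ≡ n ^ k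
length-allVecs zero    n = refl
length-allVecs (suc k) n = begin
  length (allVecs (suc k) n)                               ≡⟨ length≡∑1 (allVecs (suc k) n) ⟩
  ∑ (allVecs (suc k) n) (λ _ → 1)                          ≡⟨ ∑-allVecs-suc k n _ ⟩
  ∑ (allFin n) (λ _ → ∑ (allVecs k n) (λ _ → 1))           ≡⟨ ∑-cong (allFin n) (λ _ → trans (sym (length≡∑1 (allVecs k n))) (length-allVecs k n)) ⟩
  ∑ (allFin n) (λ _ → n ^ k)                               ≡⟨ ∑-const (allFin n) (n ^ k) ⟩
  length (allFin n) * n ^ k                                ≡⟨ cong (_* n ^ k) (length-allFin n) ⟩
  n * n ^ k                                                ∎
  where open ≡-Reasoning

-- Permutation tables

lookup-injective : ∀ {A : Set} {k} (v : Vec A k) → Unique (toList v) → Injective _≡_ _≡_ (lookup v)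
lookup-injective (x ∷ v) (x∉v ∷ v-unique) {fzero}  {fzero}  _ = refl
lookup-injective (x ∷ v) (x∉v ∷ v-unique) {fzero}  {fsuc j} x≡ = ⊥-elim (∉-lookup v x∉v j x≡)
  where
  ∉-lookup : ∀ {k} (w : Vec _ k) → All (x ≢_) (toList w) → ∀ j → x ≢ lookup w j
  ∉-lookup (y ∷ w) (x≢y ∷ _) fzero    = x≢y
  ∉-lookup (y ∷ w) (_ ∷ x∉w) (fsuc j) = ∉-lookup w x∉w j
lookup-injective (x ∷ v) (x∉v ∷ v-unique) {fsuc i} {fzero}  ≡x =
  sym (lookup-injective (x ∷ v) (x∉v ∷ v-unique) (sym ≡x))
lookup-injective (x ∷ v) (x∉v ∷ v-unique) {fsuc i} {fsuc j} e = cong fsuc (lookup-injective v v-unique e)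

toList-tabulate : ∀ {A : Set} {k} (f : Fin k → A) → toList (tabulate f) ≡ List.tabulate f
toList-tabulate {k = zero}  f = refl
toList-tabulate {k = suc k} f = cong (f fzero ∷_) (toList-tabulate (f ∘ fsuc))

tabulate-unique : ∀ {A : Set} {k} {f : Fin k → A} → Injective _≡_ _≡_ f → Unique (toList (tabulate f))
tabulate-unique {f = f} f-inj = subst Unique (sym (toList-tabulate f)) (Unique.tabulate⁺ f-inj)

injective⇒surjective : ∀ {n} (f : Fin n → Fin n) → Injective _≡_ _≡_ f → ∀ y → ∃ λ i → f i ≡ y
injective⇒surjective {suc m} f f-inj y with Fin.any? (λ i → f i Fin.≟ y)
... | yes hit = hit
... | no miss = ⊥-elim (1+n≰n (Fin.injective⇒≤ {f = avoid-y} avoid-y-injective))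
  where
  avoid-y : Fin (suc m) → Fin m
  avoid-y i = punchOut {i = y} {j = f i} (λ y≡ → miss (i , sym y≡))
  avoid-y-injective : Injective _≡_ _≡_ avoid-y
  avoid-y-injective e = f-inj (Fin.punchOut-injective (λ y≡ → miss (_ , sym y≡)) (λ y≡ → miss (_ , sym y≡)) e)

Distinct : ∀ {n k} → Vec (Fin n) k → Set
Distinct v = Unique (toList v)

distinct? : ∀ {n k} (v : Vec (Fin n) k) → Dec (Distinct v)
distinct? v = UniqueDec.unique? Fin._≟_ (toList v)

module Inverse {n} (π : Vec (Fin n) n) (π-distinct : Distinct π) where

  private
    preimage : ∀ y → ∃ λ i → lookup π i ≡ y
    preimage = injective⇒surjective (lookup π) (lookup-injective π π-distinct)

  inverse : Vec (Fin n) n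
  inverse = tabulate (proj₁ ∘ preimage)

  lookup-π-inverse : ∀ y → lookup π (lookup inverse y) ≡ y
  lookup-π-inverse y = trans (cong (lookup π) (Vec.lookup∘tabulate _ y)) (proj₂ (preimage y))

  lookup-inverse-π : ∀ i → lookup inverse (lookup π i) ≡ i
  lookup-inverse-π i = lookup-injective π π-distinct (lookup-π-inverse (lookup π i))

  inverse-distinct : Distinct inverse
  inverse-distinct = tabulate-unique (λ {x} {y} e →
    trans (sym (proj₂ (preimage x))) (trans (cong (lookup π) e) (proj₂ (preimage y))))

  inverse-unique : (σ : Vec (Fin n) n) → (∀ y → lookup π (lookup σ y) ≡ y) → σ ≡ inverse
  inverse-unique σ π∘σ = trans (sym (Vec.tabulate∘lookup σ)) (Vec.tabulate-cong (λ y →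
    lookup-injective π π-distinct (trans (π∘σ y) (sym (proj₂ (preimage y))))))

open Inverse using (inverse; inverse-distinct; lookup-π-inverse; lookup-inverse-π)

-- Inverts permutation tables and fixes all other vectors, so that it is an involution of allVecs n n.
invert : ∀ {n} → Vec (Fin n) n → Vec (Fin n) n
invert π with distinct? π
... | yes π-distinct = inverse π π-distinct
... | no _           = π

invert≡inverse : ∀ {n} (π : Vec (Fin n) n) (π-distinct : Distinct π) → invert π ≡ inverse π π-distinct
invert≡inverse π π-distinct with distinct? π
... | yes d = Inverse.inverse-unique π π-distinct (inverse π d) (lookup-π-inverse π d)
... | no ¬d = ⊥-elim (¬d π-distinct)

invert≡self : ∀ {n} (π : Vec (Fin n) n) → ¬ Distinct π → invert π ≡ π
invert≡self π ¬π-distinct with distinct? π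
... | yes d = ⊥-elim (¬π-distinct d)
... | no _  = refl

invert-involutive : ∀ {n} (π : Vec (Fin n) n) → invert (invert π) ≡ π
invert-involutive π = by-cases (distinct? π)
  where
  by-cases : Dec (Distinct π) → invert (invert π) ≡ π
  by-cases (no ¬d) = trans (cong invert (invert≡self π ¬d)) (invert≡self π ¬d)
  by-cases (yes d) = begin
    invert (invert π) ≡⟨ cong invert (invert≡inverse π d) ⟩
    invert σ          ≡⟨ invert≡inverse σ σ-distinct ⟩
    inverse σ σ-distinct ≡⟨ Inverse.inverse-unique σ σ-distinct π (lookup-inverse-π π d) ⟨
    π                 ∎
    where
    open ≡-Reasoning
    σ = inverse π d
    σ-distinct = inverse-distinct π d

module _ {n} (π : Vec (Fin n) n) (π-distinct : Distinct π) where

  lookup-invert-π : ∀ i → lookup (invert π) (lookup π i) ≡ i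
  lookup-invert-π i = trans (cong (λ σ → lookup σ (lookup π i)) (invert≡inverse π π-distinct))
                            (lookup-inverse-π π π-distinct i)

  lookup-π-invert : ∀ y → lookup π (lookup (invert π) y) ≡ y
  lookup-π-invert y = trans (cong (λ σ → lookup π (lookup σ y)) (invert≡inverse π π-distinct))
                            (lookup-π-inverse π π-distinct y)

∈-perms⇒distinct : ∀ {n} {π : Vec (Fin n) n} → π ∈ perms n → Distinct π
∈-perms⇒distinct {n} = proj₂ ∘ ∈-filter⁻ distinct? {xs = allVecs n n}

∑-perms : ∀ n (F : Vec (Fin n) n → ℕ) → ∑ (perms n) F ≡ ∑ (allVecs n n) (λ v → 𝟙 (does (distinct? v)) * F v)
∑-perms n F = ∑-filter distinct? (allVecs n n) F

distinct-invert : ∀ {n} (π : Vec (Fin n) n) → Distinct π → Distinct (invert π)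
distinct-invert π d = subst Distinct (sym (invert≡inverse π d)) (Inverse.inverse-distinct π d)

distinct?-invert : ∀ {n} (π : Vec (Fin n) n) → does (distinct? (invert π)) ≡ does (distinct? π)
distinct?-invert π = does-⇔ (mk⇔ (subst Distinct (invert-involutive π) ∘ distinct-invert (invert π)) (distinct-invert π))
                            (distinct? (invert π)) (distinct? π)

∑-perms-invert : ∀ n (F : Vec (Fin n) n → ℕ) → ∑ (perms n) (F ∘ invert) ≡ ∑ (perms n) F
∑-perms-invert n F = begin
  ∑ (perms n) (F ∘ invert)
    ≡⟨ ∑-perms n (F ∘ invert) ⟩
  ∑ (allVecs n n) (λ v → 𝟙 (does (distinct? v)) * F (invert v))
    ≡⟨ ∑-cong (allVecs n n) (λ v → cong (λ b → 𝟙 b * F (invert v)) (sym (distinct?-invert v))) ⟩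
  ∑ (allVecs n n) (λ v → 𝟙 (does (distinct? (invert v))) * F (invert v))
    ≡⟨ ∑-reindex (allVecs-enumerates n n) invert invert invert-involutive invert-involutive (λ v → 𝟙 (does (distinct? v)) * F v) ⟩
  ∑ (allVecs n n) (λ v → 𝟙 (does (distinct? v)) * F v)
    ≡⟨ ∑-perms n F ⟨
  ∑ (perms n) F                                                          ∎
  where open ≡-Reasoning

chosen : ∀ {n} → ℕ → Vec (Fin n) n → Fin n → Bool
chosen r π j = toℕ (lookup π j) <ᵇ r

hits : ∀ {n k} → (Fin n → Bool) → ℕ → Vec (Fin n) k → ℕ
hits N zero    v       = 0
hits N (suc r) []      = 0
hits N (suc r) (x ∷ v) = 𝟙 (N x) + hits N r v

hits≡∑-positions : ∀ {n k} (N : Fin n → Bool) r (v : Vec (Fin n) k) →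
                   ∑ (allFin k) (λ i → 𝟙 ((toℕ i <ᵇ r) ∧ N (lookup v i))) ≡ hits N r v
hits≡∑-positions {k = k} N zero v       = ∑-0 (allFin k)
hits≡∑-positions N (suc r) []          = refl
hits≡∑-positions {k = suc k} N (suc r) (x ∷ v) =
  trans (∑-allFin-suc k (λ i → 𝟙 ((toℕ i <ᵇ suc r) ∧ N (lookup (x ∷ v) i)))) (cong (𝟙 (N x) +_) (hits≡∑-positions N r v))

count≡∑ : ∀ {n} (p : Fin n → Bool) → count p ≡ ∑ (allFin n) (𝟙 ∘ p)
count≡∑ {n} p = length-filterᵇ p (allFin n)

count-cong : ∀ {n} {p q : Fin n → Bool} → (∀ j → p j ≡ q j) → count p ≡ count q
count-cong {n} {p} {q} p≡q = trans (count≡∑ p) (trans (∑-cong (allFin n) (cong 𝟙 ∘ p≡q)) (sym (count≡∑ q)))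

-- chosen r (invert π) consists of the first r entries of π: reindex along the bijection lookup π.
count-chosen-invert : ∀ {n} (π : Vec (Fin n) n) → Distinct π → (N : Fin n → Bool) (r : ℕ) →
                      count (λ j → chosen r (invert π) j ∧ N j) ≡ hits N r π
count-chosen-invert {n} π d N r = begin
  count (λ j → chosen r (invert π) j ∧ N j)
    ≡⟨ count≡∑ (λ j → chosen r (invert π) j ∧ N j) ⟩
  ∑ (allFin n) (λ j → 𝟙 (chosen r (invert π) j ∧ N j))
    ≡⟨ ∑-reindex (allFin-enumerates n) (lookup π) (lookup (invert π)) (lookup-invert-π π d) (lookup-π-invert π d)
                 (λ j → 𝟙 (chosen r (invert π) j ∧ N j)) ⟨
  ∑ (allFin n) (λ i → 𝟙 (chosen r (invert π) (lookup π i) ∧ N (lookup π i)))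
    ≡⟨ ∑-cong (allFin n) (λ i → cong (λ j → 𝟙 ((toℕ j <ᵇ r) ∧ N (lookup π i))) (lookup-invert-π π d i)) ⟩
  ∑ (allFin n) (λ i → 𝟙 ((toℕ i <ᵇ r) ∧ N (lookup π i)))
    ≡⟨ hits≡∑-positions N r π ⟩
  hits N r π                                                             ∎
  where open ≡-Reasoning

hits-true : ∀ {n k} r (v : Vec (Fin n) k) → r ≤ k → hits (λ _ → true) r v ≡ r
hits-true zero    v       _         = refl
hits-true (suc r) (x ∷ v) (s≤s r≤k) = cong suc (hits-true r v r≤k)

count-chosen : ∀ {n} (π : Vec (Fin n) n) → Distinct π → ∀ r → r ≤ n → count (chosen r π) ≡ r
count-chosen π d r r≤n = begin
  count (chosen r π)                                       ≡⟨ count-cong (λ j → sym (∧-identityʳ (chosen r π j))) ⟩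
  count (λ j → chosen r π j ∧ true)                        ≡⟨ cong (λ σ → count (λ j → chosen r σ j ∧ true)) (invert-involutive π) ⟨
  count (λ j → chosen r (invert (invert π)) j ∧ true)     ≡⟨ count-chosen-invert (invert π) (distinct-invert π d) (λ _ → true) r ⟩
  hits (λ _ → true) r (invert π)                           ≡⟨ hits-true r (invert π) r≤n ⟩
  r                                                        ∎
  where open ≡-Reasoning

-- Counting injective sequences

falling : ℕ → ℕ → ℕ
falling m zero    = 1
falling m (suc k) = m * falling (pred m) k

falling-+ : ∀ m a b → falling m (a + b) ≡ falling m a * falling (m ∸ a) b
falling-+ m zero    b = sym (+-identityʳ _)
falling-+ m (suc a) b = begin
  m * falling (pred m) (a + b)                           ≡⟨ cong (m *_) (falling-+ (pred m) a b) ⟩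
  m * (falling (pred m) a * falling (pred m ∸ a) b)      ≡⟨ cong (λ k → m * (falling (pred m) a * falling k b)) (pred[m∸n]≡m∸[1+n]′ m a) ⟩
  m * (falling (pred m) a * falling (m ∸ suc a) b)       ≡⟨ *-assoc m _ _ ⟨
  m * falling (pred m) a * falling (m ∸ suc a) b         ∎
  where
  open ≡-Reasoning
  pred[m∸n]≡m∸[1+n]′ : ∀ m a → pred m ∸ a ≡ m ∸ suc a
  pred[m∸n]≡m∸[1+n]′ zero    a = trans (0∸n≡0 a) (sym (0∸n≡0 (suc a)))
  pred[m∸n]≡m∸[1+n]′ (suc m) a = refl

module _ {n : ℕ} where

  uniqueᵇ : List (Fin n) → Bool
  uniqueᵇ F = does (UniqueDec.unique? Fin._≟_ F)

  𝟙-unique : ∀ F → Unique F → 𝟙 (uniqueᵇ F) ≡ 1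
  𝟙-unique F F-unique = cong 𝟙 (dec-true (UniqueDec.unique? Fin._≟_ F) F-unique)

  𝟙-nonunique : ∀ F → ¬ Unique F → 𝟙 (uniqueᵇ F) ≡ 0
  𝟙-nonunique F ¬F-unique = cong 𝟙 (dec-false (UniqueDec.unique? Fin._≟_ F) ¬F-unique)

  occurrences : List (Fin n) → Fin n → ℕ
  occurrences F x = ∑ F (λ f → 𝟙 (does (x Fin.≟ f)))

  ∑-occurrences : ∀ F → ∑ (allFin n) (occurrences F) ≡ length F
  ∑-occurrences F = begin
    ∑ (allFin n) (λ x → ∑ F (λ f → 𝟙 (does (x Fin.≟ f)))) ≡⟨ ∑-swap (allFin n) F _ ⟩
    ∑ F (λ f → ∑ (allFin n) (λ x → 𝟙 (does (x Fin.≟ f)))) ≡⟨ ∑-cong F (Enumerates.occurs-once (allFin-enumerates n)) ⟩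
    ∑ F (λ _ → 1)                                         ≡⟨ length≡∑1 F ⟨
    length F                                              ∎
    where open ≡-Reasoning

  𝟙-unique-snoc+occurrences : ∀ F → Unique F → ∀ x → 𝟙 (uniqueᵇ (F ++ [ x ])) + occurrences F x ≡ 1
  𝟙-unique-snoc+occurrences []      _ x = cong (_+ 0) (𝟙-unique [ x ] ([] ∷ []))
  𝟙-unique-snoc+occurrences (f ∷ F) (f∉F ∷ F-unique) x with x Fin.≟ f
  ... | yes refl = cong₂ _+_ (𝟙-nonunique (x ∷ F ++ [ x ]) x-twice) (cong suc (absent F f∉F))
    where
    x-twice : ¬ Unique (x ∷ F ++ [ x ])
    x-twice (x∉ ∷ _) with All.++⁻ʳ F x∉
    ... | x≢x ∷ [] = x≢x refl
    absent : ∀ G → All (x ≢_) G → occurrences G x ≡ 0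
    absent []      []           = refl
    absent (g ∷ G) (x≢g ∷ x∉G) with x Fin.≟ g
    ... | yes x≡g = ⊥-elim (x≢g x≡g)
    ... | no _    = absent G x∉G
  ... | no x≢f = trans (cong (_+ occurrences F x) (unique-cons f∉F⁺)) (𝟙-unique-snoc+occurrences F F-unique x)
    where
    f∉F⁺ : All (f ≢_) (F ++ [ x ])
    f∉F⁺ = All.++⁺ f∉F ((x≢f ∘ sym) ∷ [])
    unique-cons : ∀ {G} → All (f ≢_) G → 𝟙 (uniqueᵇ (f ∷ G)) ≡ 𝟙 (uniqueᵇ G)
    unique-cons {G} f∉G = by-cases (UniqueDec.unique? Fin._≟_ G)
      where
      by-cases : Dec (Unique G) → 𝟙 (uniqueᵇ (f ∷ G)) ≡ 𝟙 (uniqueᵇ G)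
      by-cases (yes G-unique) = trans (𝟙-unique (f ∷ G) (f∉G ∷ G-unique)) (sym (𝟙-unique G G-unique))
      by-cases (no ¬G-unique) = trans (𝟙-nonunique (f ∷ G) (λ { (_ ∷ G-unique) → ¬G-unique G-unique })) (sym (𝟙-nonunique G ¬G-unique))

  ∑-unique-snoc : ∀ F → Unique F → ∑ (allFin n) (λ x → 𝟙 (uniqueᵇ (F ++ [ x ]))) ≡ n ∸ length F
  ∑-unique-snoc F F-unique = begin
    S                                                                       ≡⟨ m+n∸n≡m S (length F) ⟨
    S + length F ∸ length F                                                 ≡⟨ cong (λ k → S + k ∸ length F) (∑-occurrences F) ⟨
    S + ∑ (allFin n) (occurrences F) ∸ length F                             ≡⟨ cong (_∸ length F) (∑-+ (allFin n) _ (occurrences F)) ⟨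
    ∑ (allFin n) (λ x → 𝟙 (uniqueᵇ (F ++ [ x ])) + occurrences F x) ∸ length F ≡⟨ cong (_∸ length F) (∑-cong (allFin n) (𝟙-unique-snoc+occurrences F F-unique)) ⟩
    ∑ (allFin n) (λ _ → 1) ∸ length F                                       ≡⟨ cong (_∸ length F) (trans (sym (length≡∑1 (allFin n))) (length-allFin n)) ⟩
    n ∸ length F                                                            ∎
    where
    open ≡-Reasoning
    S = ∑ (allFin n) (λ x → 𝟙 (uniqueᵇ (F ++ [ x ])))

  unique-++⁻ˡ : (F G : List (Fin n)) → Unique (F ++ G) → Unique F
  unique-++⁻ˡ []      G _                = []
  unique-++⁻ˡ (f ∷ F) G (f∉FG ∷ FG-unique) = All.++⁻ˡ F f∉FG ∷ unique-++⁻ˡ F G FG-unique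

  ∑-unique-extensions-of-nonunique : ∀ k F → ¬ Unique F → ∑ (allVecs k n) (λ v → 𝟙 (uniqueᵇ (F ++ toList v))) ≡ 0
  ∑-unique-extensions-of-nonunique k F ¬F-unique = trans
    (∑-cong (allVecs k n) (λ v → 𝟙-nonunique (F ++ toList v) (¬F-unique ∘ unique-++⁻ˡ F (toList v))))
    (∑-0 (allVecs k n))

  ∑-unique-extensions : ∀ k F → Unique F → ∑ (allVecs k n) (λ v → 𝟙 (uniqueᵇ (F ++ toList v))) ≡ falling (n ∸ length F) k
  ∑-unique-extensions zero    F F-unique =
    trans (+-identityʳ _) (trans (cong (𝟙 ∘ uniqueᵇ) (++-identityʳ F)) (𝟙-unique F F-unique))
  ∑-unique-extensions (suc k) F F-unique = begin
    ∑ (allVecs (suc k) n) (λ v → 𝟙 (uniqueᵇ (F ++ toList v)))                      ≡⟨ ∑-allVecs-suc k n _ ⟩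
    ∑ (allFin n) (λ x → ∑ (allVecs k n) (λ w → 𝟙 (uniqueᵇ (F ++ x ∷ toList w))))   ≡⟨ ∑-cong (allFin n) extend ⟩
    ∑ (allFin n) (λ x → 𝟙 (uniqueᵇ (F ++ [ x ])) * falling (n ∸ suc (length F)) k) ≡⟨ ∑-*ʳ (allFin n) _ _ ⟩
    ∑ (allFin n) (λ x → 𝟙 (uniqueᵇ (F ++ [ x ]))) * falling (n ∸ suc (length F)) k
      ≡⟨ cong₂ _*_ (∑-unique-snoc F F-unique) (cong (λ m → falling m k) (sym (pred[m∸n]≡m∸[1+n] n (length F)))) ⟩
    (n ∸ length F) * falling (pred (n ∸ length F)) k                                 ∎
    where
    open ≡-Reasoning
    extend : ∀ x → ∑ (allVecs k n) (λ w → 𝟙 (uniqueᵇ (F ++ x ∷ toList w)))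
                   ≡ 𝟙 (uniqueᵇ (F ++ [ x ])) * falling (n ∸ suc (length F)) k
    extend x = trans (∑-cong (allVecs k n) (λ w → cong (𝟙 ∘ uniqueᵇ) (sym (++-assoc F [ x ] (toList w)))))
                     (by-cases (UniqueDec.unique? Fin._≟_ (F ++ [ x ])))
      where
      by-cases : Dec (Unique (F ++ [ x ])) →
                 ∑ (allVecs k n) (λ w → 𝟙 (uniqueᵇ ((F ++ [ x ]) ++ toList w)))
                 ≡ 𝟙 (uniqueᵇ (F ++ [ x ])) * falling (n ∸ suc (length F)) k
      by-cases (yes Fx-unique) = begin
        ∑ (allVecs k n) (λ w → 𝟙 (uniqueᵇ ((F ++ [ x ]) ++ toList w))) ≡⟨ ∑-unique-extensions k (F ++ [ x ]) Fx-unique ⟩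
        falling (n ∸ length (F ++ [ x ])) k                          ≡⟨ cong (λ m → falling (n ∸ m) k) (trans (length-++ F) (+-comm (length F) 1)) ⟩
        falling (n ∸ suc (length F)) k                               ≡⟨ *-identityˡ _ ⟨
        1 * falling (n ∸ suc (length F)) k                           ≡⟨ cong (_* falling (n ∸ suc (length F)) k) (𝟙-unique (F ++ [ x ]) Fx-unique) ⟨
        𝟙 (uniqueᵇ (F ++ [ x ])) * falling (n ∸ suc (length F)) k    ∎
      by-cases (no ¬Fx-unique) = trans (∑-unique-extensions-of-nonunique k (F ++ [ x ]) ¬Fx-unique)
        (cong (_* falling (n ∸ suc (length F)) k) (sym (𝟙-nonunique (F ++ [ x ]) ¬Fx-unique)))

  ∑-unique-extensions-≤ : ∀ k F → ∑ (allVecs k n) (λ v → 𝟙 (uniqueᵇ (F ++ toList v))) ≤ falling (n ∸ length F) k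
  ∑-unique-extensions-≤ k F with UniqueDec.unique? Fin._≟_ F
  ... | yes F-unique = ≤-reflexive (∑-unique-extensions k F F-unique)
  ... | no ¬F-unique = ≤-trans (≤-reflexive (∑-unique-extensions-of-nonunique k F ¬F-unique)) z≤n

  -- Dropping uniqueness of the first r entries turns them into r independent uniform draws.
  ∑-unique-by-prefix-hits : (N : Fin n → Bool) (Φ : ℕ → ℕ) → ∀ r k F → r ≤ k →
    ∑ (allVecs k n) (λ v → 𝟙 (uniqueᵇ (F ++ toList v)) * Φ (hits N r v))
    ≤ falling (n ∸ length F ∸ r) (k ∸ r) * ∑ (allVecs r n) (Φ ∘ hits N r)
  ∑-unique-by-prefix-hits N Φ zero k F _ = begin
    ∑ (allVecs k n) (λ v → 𝟙 (uniqueᵇ (F ++ toList v)) * Φ 0) ≡⟨ ∑-*ʳ (allVecs k n) (Φ 0) _ ⟩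
    ∑ (allVecs k n) (λ v → 𝟙 (uniqueᵇ (F ++ toList v))) * Φ 0 ≤⟨ *-monoˡ-≤ (Φ 0) (∑-unique-extensions-≤ k F) ⟩
    falling (n ∸ length F) k * Φ 0                            ≡⟨ cong (falling (n ∸ length F) k *_) (+-identityʳ (Φ 0)) ⟨
    falling (n ∸ length F) k * (Φ 0 + 0)                      ∎
    where open ≤-Reasoning
  ∑-unique-by-prefix-hits N Φ (suc r) (suc k) F (s≤s r≤k) = begin
    ∑ (allVecs (suc k) n) (λ v → 𝟙 (uniqueᵇ (F ++ toList v)) * Φ (hits N (suc r) v))
      ≡⟨ ∑-allVecs-suc k n _ ⟩
    ∑ (allFin n) (λ x → ∑ (allVecs k n) (λ w → 𝟙 (uniqueᵇ (F ++ x ∷ toList w)) * Φ (𝟙 (N x) + hits N r w)))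
      ≡⟨ ∑-cong (allFin n) (λ x → ∑-cong (allVecs k n) (λ w →
           cong (λ G → 𝟙 (uniqueᵇ G) * Φ (𝟙 (N x) + hits N r w)) (sym (++-assoc F [ x ] (toList w))))) ⟩
    ∑ (allFin n) (λ x → ∑ (allVecs k n) (λ w → 𝟙 (uniqueᵇ ((F ++ [ x ]) ++ toList w)) * Φ (𝟙 (N x) + hits N r w)))
      ≤⟨ ∑-mono-≤ (allFin n) (λ x → ∑-unique-by-prefix-hits N (λ t → Φ (𝟙 (N x) + t)) r k (F ++ [ x ]) r≤k) ⟩
    ∑ (allFin n) (λ x → falling (n ∸ length (F ++ [ x ]) ∸ r) (k ∸ r) * ∑ (allVecs r n) (λ w → Φ (𝟙 (N x) + hits N r w)))
      ≡⟨ ∑-cong (allFin n) (λ x → cong (λ m → falling (n ∸ m ∸ r) (k ∸ r) * _) (trans (length-++ F) (+-comm (length F) 1))) ⟩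
    ∑ (allFin n) (λ x → falling (n ∸ suc (length F) ∸ r) (k ∸ r) * ∑ (allVecs r n) (λ w → Φ (𝟙 (N x) + hits N r w)))
      ≡⟨ ∑-*ˡ (allFin n) (falling (n ∸ suc (length F) ∸ r) (k ∸ r)) (λ x → ∑ (allVecs r n) (λ w → Φ (𝟙 (N x) + hits N r w))) ⟩
    falling (n ∸ suc (length F) ∸ r) (k ∸ r) * ∑ (allFin n) (λ x → ∑ (allVecs r n) (λ w → Φ (𝟙 (N x) + hits N r w)))
      ≡⟨ cong₂ _*_ (cong (λ m → falling m (k ∸ r)) (∸-shift n (length F) r)) (∑-allVecs-suc r n _) ⟨
    falling (n ∸ length F ∸ suc r) (k ∸ r) * ∑ (allVecs (suc r) n) (Φ ∘ hits N (suc r)) ∎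
    where
    open ≤-Reasoning
    ∸-shift : ∀ m a b → m ∸ a ∸ suc b ≡ m ∸ suc a ∸ b
    ∸-shift m a b = begin-equality
      m ∸ a ∸ suc b   ≡⟨ ∸-+-assoc m a (suc b) ⟩
      m ∸ (a + suc b) ≡⟨ cong (m ∸_) (+-suc a b) ⟩
      m ∸ suc (a + b) ≡⟨ ∸-+-assoc m (suc a) b ⟨
      m ∸ suc a ∸ b   ∎

length-perms : ∀ n → length (perms n) ≡ falling n n
length-perms n = begin
  length (perms n)                                              ≡⟨ length≡∑1 (perms n) ⟩
  ∑ (perms n) (λ _ → 1)                                         ≡⟨ ∑-perms n (λ _ → 1) ⟩
  ∑ (allVecs n n) (λ v → 𝟙 (does (distinct? v)) * 1)            ≡⟨ ∑-cong (allVecs n n) (λ v → *-identityʳ _) ⟩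
  ∑ (allVecs n n) (λ v → 𝟙 (does (distinct? v)))                ≡⟨ ∑-unique-extensions n [] [] ⟩
  falling n n                                                   ∎
  where open ≡-Reasoning

∑-perms-hits≤ : ∀ {n} (N : Fin n → Bool) (Φ : ℕ → ℕ) r → r ≤ n →
  ∑ (perms n) (Φ ∘ hits N r) ≤ falling (n ∸ r) (n ∸ r) * ∑ (allVecs r n) (Φ ∘ hits N r)
∑-perms-hits≤ {n} N Φ r r≤n = begin
  ∑ (perms n) (Φ ∘ hits N r)                                     ≡⟨ ∑-perms n (Φ ∘ hits N r) ⟩
  ∑ (allVecs n n) (λ v → 𝟙 (does (distinct? v)) * Φ (hits N r v)) ≤⟨ ∑-unique-by-prefix-hits N Φ r n [] r≤n ⟩
  falling (n ∸ r) (n ∸ r) * ∑ (allVecs r n) (Φ ∘ hits N r)       ∎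
  where open ≤-Reasoning

falling-lower-bound : ∀ n k → k ≤ n → n * n ^ k ≤ n * falling n k + k * k * n ^ k
falling-lower-bound n zero    _    = m≤m+n (n * 1) 0
falling-lower-bound n (suc k) k<n = begin
  n * (n * P)                                      ≡⟨ cong (_* (n * P)) n≡k+m ⟩
  (k + m) * (n * P)                                ≡⟨ *-distribʳ-+ (n * P) k m ⟩
  k * (n * P) + m * (n * P)                        ≤⟨ +-monoʳ-≤ (k * (n * P)) (*-monoʳ-≤ m (falling-lower-bound n k k≤n)) ⟩
  k * (n * P) + m * (n * F + k * k * P)            ≡⟨ regroup k m n P F ⟩
  n * (F * (m * 1)) + (k * (n * P) + m * (k * k * P)) ≤⟨ +-monoʳ-≤ (n * (F * (m * 1))) (+-monoʳ-≤ (k * (n * P)) (*-monoˡ-≤ (k * k * P) (m∸n≤m n k))) ⟩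
  n * (F * (m * 1)) + (k * (n * P) + n * (k * k * P)) ≤⟨ +-monoʳ-≤ (n * (F * (m * 1))) (m≤m+n _ (suc k * (n * P))) ⟩
  n * (F * (m * 1)) + (k * (n * P) + n * (k * k * P) + suc k * (n * P)) ≡⟨ cong₂ _+_ (cong (n *_) (sym (trans (cong (falling n) (+-comm 1 k)) (falling-+ n k 1)))) (square k n P) ⟩
  n * falling n (suc k) + suc k * suc k * (n * P)  ∎
  where
  open ≤-Reasoning
  P = n ^ k
  F = falling n k
  m = n ∸ k
  k≤n : k ≤ n
  k≤n = ≤-trans (n≤1+n k) k<n
  n≡k+m : n ≡ k + m
  n≡k+m = sym (m+[n∸m]≡n k≤n)
  regroup : ∀ k m n P F → k * (n * P) + m * (n * F + k * k * P) ≡ n * (F * (m * 1)) + (k * (n * P) + m * (k * k * P))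
  regroup = solve-∀
  square : ∀ k n P → k * (n * P) + n * (k * k * P) + suc k * (n * P) ≡ suc k * suc k * (n * P)
  square = solve-∀

r≤r*r : ∀ r → r ≤ r * r
r≤r*r zero    = z≤n
r≤r*r (suc r) = m≤m*n (suc r) (suc r)

^≤2*falling : ∀ n r → 2 * (r * r) ≤ n → n ^ r ≤ 2 * falling n r
^≤2*falling zero    zero    _ = s≤s z≤n
^≤2*falling (suc n′) r 2r²≤n = *-cancelˡ-≤ n (+-cancelʳ-≤ (n * n ^ r) _ _ (begin
  n * n ^ r + n * n ^ r                     ≡⟨ +-*-double n (n ^ r) ⟩
  2 * (n * n ^ r)                           ≤⟨ *-monoʳ-≤ 2 (falling-lower-bound n r r≤n) ⟩
  2 * (n * falling n r + r * r * n ^ r)     ≡⟨ expand n r (falling n r) (n ^ r) ⟩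
  n * (2 * falling n r) + 2 * (r * r) * n ^ r ≤⟨ +-monoʳ-≤ (n * (2 * falling n r)) (*-monoˡ-≤ (n ^ r) 2r²≤n) ⟩
  n * (2 * falling n r) + n * n ^ r         ∎))
  where
  open ≤-Reasoning
  n = suc n′
  r≤n : r ≤ n
  r≤n = ≤-trans (≤-trans (r≤r*r r) (m≤n*m (r * r) 2)) 2r²≤n
  +-*-double : ∀ a b → a * b + a * b ≡ 2 * (a * b)
  +-*-double = solve-∀
  expand : ∀ n r F P → 2 * (n * F + r * r * P) ≡ n * (2 * F) + 2 * (r * r) * P
  expand = solve-∀

-- Sampling with replacement

module WithReplacement {n : ℕ} (N : Fin n → Bool) where

  open import Data.Integer using (+_; ∣_∣; 0ℤ)

  d : ℕ
  d = count N

  centred : Fin n → ℤ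
  centred x = + (n * 𝟙 (N x)) ℤ.- + d

  -- n times the deviation of the number of draws from N among w from its mean d r / n.
  deviation : ∀ r → Vec (Fin n) r → ℤ
  deviation r w = + (n * hits N r w) ℤ.- + (d * r)

  deviation-∷ : ∀ r x w → deviation (suc r) (x ∷ w) ≡ centred x ℤ.+ deviation r w
  deviation-∷ r x w = begin
    + (n * (𝟙 (N x) + hits N r w)) ℤ.- + (d * suc r)
      ≡⟨ cong₂ ℤ._-_ (trans (ℤ.pos-* n _) (cong (λ i → + n ℤ.* i) (ℤ.pos-+ (𝟙 (N x)) _)))
                     (trans (cong +_ (*-suc d r)) (trans (ℤ.pos-+ d _) (cong (λ i → + d ℤ.+ i) (ℤ.pos-* d r)))) ⟩
    + n ℤ.* (+ 𝟙 (N x) ℤ.+ + hits N r w) ℤ.- (+ d ℤ.+ + d ℤ.* + r)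
      ≡⟨ regroup (+ n) (+ 𝟙 (N x)) (+ hits N r w) (+ d) (+ r) ⟩
    (+ n ℤ.* + 𝟙 (N x) ℤ.- + d) ℤ.+ (+ n ℤ.* + hits N r w ℤ.- + d ℤ.* + r)
      ≡⟨ cong₂ ℤ._+_ (cong (λ i → i ℤ.- + d) (sym (ℤ.pos-* n _))) (cong₂ ℤ._-_ (sym (ℤ.pos-* n _)) (sym (ℤ.pos-* d r))) ⟩
    centred x ℤ.+ deviation r w ∎
    where
    open ≡-Reasoning
    regroup : ∀ a b c e f → a ℤ.* (b ℤ.+ c) ℤ.- (e ℤ.+ e ℤ.* f) ≡ (a ℤ.* b ℤ.- e) ℤ.+ (a ℤ.* c ℤ.- e ℤ.* f)
    regroup = ℤ.solve-∀

  deviation-[] : deviation 0 [] ≡ 0ℤ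
  deviation-[] = cong₂ (λ a b → + a ℤ.- + b) (*-zeroʳ n) (*-zeroʳ d)

  ∑-centred : ∑ℤ (allFin n) centred ≡ 0ℤ
  ∑-centred = begin
    ∑ℤ (allFin n) (λ x → + (n * 𝟙 (N x)) ℤ.+ ℤ.- + d)
      ≡⟨ ℤ∑.∑-+ (allFin n) _ _ ⟩
    ∑ℤ (allFin n) (λ x → + (n * 𝟙 (N x))) ℤ.+ ∑ℤ (allFin n) (λ _ → ℤ.- + d)
      ≡⟨ cong₂ ℤ._+_ (trans (∑ℤ-pos (allFin n) _) (cong +_ (trans (∑-*ˡ (allFin n) n (𝟙 ∘ N)) (cong (n *_) (sym (count≡∑ N))))))
                     (trans (∑ℤ-const (allFin n) _) (cong (λ m → + m ℤ.* ℤ.- + d) (length-allFin n))) ⟩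
    + (n * d) ℤ.+ + n ℤ.* ℤ.- + d
      ≡⟨ cong (ℤ._+ + n ℤ.* ℤ.- + d) (ℤ.pos-* n d) ⟩
    + n ℤ.* + d ℤ.+ + n ℤ.* ℤ.- + d
      ≡⟨ cancel (+ n) (+ d) ⟩
    0ℤ ∎
    where
    open ≡-Reasoning
    cancel : ∀ a b → a ℤ.* b ℤ.+ a ℤ.* ℤ.- b ≡ 0ℤ
    cancel = ℤ.solve-∀

  ∑-deviation : ∀ r → ∑ℤ (allVecs r n) (deviation r) ≡ 0ℤ
  ∑-deviation zero    = cong (ℤ._+ 0ℤ) deviation-[]
  ∑-deviation (suc r) = begin
    ∑ℤ (allVecs (suc r) n) (deviation (suc r))                                   ≡⟨ ℤ∑.∑-allVecs-suc r n _ ⟩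
    ∑ℤ (allFin n) (λ x → ∑ℤ (allVecs r n) (λ w → deviation (suc r) (x ∷ w)))     ≡⟨ ℤ∑.∑-cong (allFin n) (λ x → ℤ∑.∑-cong (allVecs r n) (deviation-∷ r x)) ⟩
    ∑ℤ (allFin n) (λ x → ∑ℤ (allVecs r n) (λ w → centred x ℤ.+ deviation r w))   ≡⟨ ∑∑-+ (allFin n) (allVecs r n) centred (deviation r) ∑-centred ⟩
    + length (allFin n) ℤ.* ∑ℤ (allVecs r n) (deviation r)                        ≡⟨ cong (+ length (allFin n) ℤ.*_) (∑-deviation r) ⟩
    + length (allFin n) ℤ.* 0ℤ                                                    ≡⟨ ℤ.*-zeroʳ (+ length (allFin n)) ⟩
    0ℤ                                                                            ∎
    where open ≡-Reasoning

  S₂ S₄ : ℕ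
  S₂ = ∑ (allFin n) (λ x → ∣ centred x ∣ ^ 2)
  S₄ = ∑ (allFin n) (λ x → ∣ centred x ∣ ^ 4)

  M₂ M₄ : ℕ → ℕ
  M₂ r = ∑ (allVecs r n) (λ w → ∣ deviation r w ∣ ^ 2)
  M₄ r = ∑ (allVecs r n) (λ w → ∣ deviation r w ∣ ^ 4)

  private
    ∑ℤ-deviation-suc : ∀ r (f : ℤ → ℤ) → ∑ℤ (allVecs (suc r) n) (f ∘ deviation (suc r))
                       ≡ ∑ℤ (allFin n) (λ x → ∑ℤ (allVecs r n) (λ w → f (centred x ℤ.+ deviation r w)))
    ∑ℤ-deviation-suc r f = trans (ℤ∑.∑-allVecs-suc r n _)
      (ℤ∑.∑-cong (allFin n) (λ x → ℤ∑.∑-cong (allVecs r n) (λ w → cong f (deviation-∷ r x w))))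

  M₂-suc : ∀ r → M₂ (suc r) ≡ n ^ r * S₂ + n * M₂ r
  M₂-suc r = ℤ.+-injective (begin
    + M₂ (suc r)
      ≡⟨ pos-∑∣∣^2 (allVecs (suc r) n) (deviation (suc r)) ⟩
    ∑ℤ (allVecs (suc r) n) (λ w → deviation (suc r) w ℤ.^ 2)
      ≡⟨ ∑ℤ-deviation-suc r (ℤ._^ 2) ⟩
    ∑ℤ (allFin n) (λ x → ∑ℤ (allVecs r n) (λ w → (centred x ℤ.+ deviation r w) ℤ.^ 2))
      ≡⟨ ∑∑-+-^2 (allFin n) (allVecs r n) centred (deviation r) ∑-centred ⟩
    + length (allVecs r n) ℤ.* ∑ℤ (allFin n) (λ x → centred x ℤ.^ 2)
      ℤ.+ + length (allFin n) ℤ.* ∑ℤ (allVecs r n) (λ w → deviation r w ℤ.^ 2)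
      ≡⟨ cong₂ ℤ._+_ (cong₂ ℤ._*_ (cong +_ (length-allVecs r n)) (sym (pos-∑∣∣^2 (allFin n) centred)))
                     (cong₂ ℤ._*_ (cong +_ (length-allFin n)) (sym (pos-∑∣∣^2 (allVecs r n) (deviation r)))) ⟩
    + (n ^ r) ℤ.* + S₂ ℤ.+ + n ℤ.* + M₂ r
      ≡⟨ cong₂ ℤ._+_ (ℤ.pos-* (n ^ r) S₂) (ℤ.pos-* n (M₂ r)) ⟨
    + (n ^ r * S₂) ℤ.+ + (n * M₂ r)
      ≡⟨ ℤ.pos-+ (n ^ r * S₂) (n * M₂ r) ⟨
    + (n ^ r * S₂ + n * M₂ r) ∎)
    where open ≡-Reasoning

  M₄-suc : ∀ r → M₄ (suc r) ≡ n ^ r * S₄ + 6 * S₂ * M₂ r + n * M₄ r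
  M₄-suc r = ℤ.+-injective (begin
    + M₄ (suc r)
      ≡⟨ pos-∑∣∣^4 (allVecs (suc r) n) (deviation (suc r)) ⟩
    ∑ℤ (allVecs (suc r) n) (λ w → deviation (suc r) w ℤ.^ 4)
      ≡⟨ ∑ℤ-deviation-suc r (ℤ._^ 4) ⟩
    ∑ℤ (allFin n) (λ x → ∑ℤ (allVecs r n) (λ w → (centred x ℤ.+ deviation r w) ℤ.^ 4))
      ≡⟨ ∑∑-+-^4 (allFin n) (allVecs r n) centred (deviation r) ∑-centred (∑-deviation r) ⟩
    + length (allVecs r n) ℤ.* ∑ℤ (allFin n) (λ x → centred x ℤ.^ 4)
      ℤ.+ + 6 ℤ.* ∑ℤ (allFin n) (λ x → centred x ℤ.^ 2) ℤ.* ∑ℤ (allVecs r n) (λ w → deviation r w ℤ.^ 2)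
      ℤ.+ + length (allFin n) ℤ.* ∑ℤ (allVecs r n) (λ w → deviation r w ℤ.^ 4)
      ≡⟨ cong₂ ℤ._+_ (cong₂ ℤ._+_ (cong₂ ℤ._*_ (cong +_ (length-allVecs r n)) (sym (pos-∑∣∣^4 (allFin n) centred)))
                                  (cong₂ (λ u v → + 6 ℤ.* u ℤ.* v) (sym (pos-∑∣∣^2 (allFin n) centred)) (sym (pos-∑∣∣^2 (allVecs r n) (deviation r)))))
                     (cong₂ ℤ._*_ (cong +_ (length-allFin n)) (sym (pos-∑∣∣^4 (allVecs r n) (deviation r)))) ⟩
    + (n ^ r) ℤ.* + S₄ ℤ.+ + 6 ℤ.* + S₂ ℤ.* + M₂ r ℤ.+ + n ℤ.* + M₄ r
      ≡⟨ cong₂ ℤ._+_ (cong₂ ℤ._+_ (ℤ.pos-* (n ^ r) S₄) (trans (ℤ.pos-* (6 * S₂) (M₂ r)) (cong (ℤ._* + M₂ r) (ℤ.pos-* 6 S₂)))) (ℤ.pos-* n (M₄ r)) ⟨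
    + (n ^ r * S₄) ℤ.+ + (6 * S₂ * M₂ r) ℤ.+ + (n * M₄ r)
      ≡⟨ trans (cong (ℤ._+ + (n * M₄ r)) (ℤ.pos-+ (n ^ r * S₄) _)) (ℤ.pos-+ (n ^ r * S₄ + 6 * S₂ * M₂ r) _) ⟨
    + (n ^ r * S₄ + 6 * S₂ * M₂ r + n * M₄ r) ∎)
    where open ≡-Reasoning

  private
    ∣+a-+b∣≤ : ∀ {a b m} → a ≤ m → b ≤ m → ∣ + a ℤ.- + b ∣ ≤ m
    ∣+a-+b∣≤ {a} {b} {m} a≤m b≤m = begin
      ∣ + a ℤ.- + b ∣ ≡⟨ cong ∣_∣ (ℤ.m-n≡m⊖n a b) ⟩
      ∣ a ℤ.⊖ b ∣     ≤⟨ ℤ.∣m⊝n∣≤m⊔n a b ⟩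
      a ⊔ b           ≤⟨ ⊔-lub a≤m b≤m ⟩
      m               ∎
      where open ≤-Reasoning

    ∑-allFin-≤ : ∀ {f : Fin n → ℕ} {c} → (∀ x → f x ≤ c) → ∑ (allFin n) f ≤ n * c
    ∑-allFin-≤ {f} {c} f≤c = ≤-trans (∑-mono-≤ (allFin n) f≤c)
      (≤-reflexive (trans (∑-const (allFin n) c) (cong (_* c) (length-allFin n))))

  d≤n : d ≤ n
  d≤n = begin
    count N                  ≡⟨ count≡∑ N ⟩
    ∑ (allFin n) (𝟙 ∘ N)      ≤⟨ ∑-allFin-≤ (𝟙≤1 ∘ N) ⟩
    n * 1                    ≡⟨ *-identityʳ n ⟩
    n                        ∎
    where open ≤-Reasoning

  ∣centred∣≤n : ∀ x → ∣ centred x ∣ ≤ n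
  ∣centred∣≤n x = ∣+a-+b∣≤ (≤-trans (*-monoʳ-≤ n (𝟙≤1 (N x))) (≤-reflexive (*-identityʳ n))) d≤n

  S₂≤ : S₂ ≤ n * n ^ 2
  S₂≤ = ∑-allFin-≤ (λ x → ^-monoˡ-≤ 2 (∣centred∣≤n x))

  S₄≤ : S₄ ≤ n * n ^ 4
  S₄≤ = ∑-allFin-≤ (λ x → ^-monoˡ-≤ 4 (∣centred∣≤n x))

  M₂≤ : ∀ r → M₂ r ≤ r * n ^ r * n ^ 2
  M₂≤ zero    = ≤-reflexive (cong (λ i → ∣ i ∣ ^ 2 + 0) deviation-[])
  M₂≤ (suc r) = begin
    M₂ (suc r)                                         ≡⟨ M₂-suc r ⟩
    n ^ r * S₂ + n * M₂ r                              ≤⟨ +-mono-≤ (*-monoʳ-≤ (n ^ r) S₂≤) (*-monoʳ-≤ n (M₂≤ r)) ⟩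
    n ^ r * (n * n ^ 2) + n * (r * n ^ r * n ^ 2)      ≡⟨ collect n r (n ^ r) ⟩
    suc r * n ^ suc r * n ^ 2                          ∎
    where
    open ≤-Reasoning
    collect : ∀ n r P → P * (n * (n * (n * 1))) + n * (r * P * (n * (n * 1))) ≡ suc r * (n * P) * (n * (n * 1))
    collect = solve-∀

  M₄≤ : ∀ r → M₄ r ≤ 3 * r ^ 2 * n ^ r * n ^ 4
  M₄≤ zero    = ≤-reflexive (cong (λ i → ∣ i ∣ ^ 4 + 0) deviation-[])
  M₄≤ (suc r) = begin
    M₄ (suc r)
      ≡⟨ M₄-suc r ⟩
    n ^ r * S₄ + 6 * S₂ * M₂ r + n * M₄ r
      ≤⟨ +-mono-≤ (+-mono-≤ (*-monoʳ-≤ (n ^ r) S₄≤) (*-mono-≤ (*-monoʳ-≤ 6 S₂≤) (M₂≤ r))) (*-monoʳ-≤ n (M₄≤ r)) ⟩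
    n ^ r * (n * n ^ 4) + 6 * (n * n ^ 2) * (r * n ^ r * n ^ 2) + n * (3 * r ^ 2 * n ^ r * n ^ 4)
      ≤⟨ m≤m+n _ (2 * (n ^ suc r * n ^ 4)) ⟩
    n ^ r * (n * n ^ 4) + 6 * (n * n ^ 2) * (r * n ^ r * n ^ 2) + n * (3 * r ^ 2 * n ^ r * n ^ 4) + 2 * (n ^ suc r * n ^ 4)
      ≡⟨ collect n r (n ^ r) ⟩
    3 * suc r ^ 2 * n ^ suc r * n ^ 4 ∎
    where
    open ≤-Reasoning
    collect : ∀ n r P →
      P * (n * (n * (n * (n * (n * 1))))) + 6 * (n * (n * (n * 1))) * (r * P * (n * (n * 1)))
        + n * (3 * (r * (r * 1)) * P * (n * (n * (n * (n * 1))))) + 2 * (n * P * (n * (n * (n * (n * 1)))))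
      ≡ 3 * (suc r * (suc r * 1)) * (n * P) * (n * (n * (n * (n * 1))))
    collect = solve-∀

  -- t falls short of its mean d r / n by more than e / (c n).
  deficient : (c e r t : ℕ) → Bool
  deficient c e r t = c * (n * t) + e <ᵇ c * (d * r)

  deficient⇒gap≤ : ∀ c e r t → T (deficient c e r t) → e ≤ c * ∣ + (n * t) ℤ.- + (d * r) ∣
  deficient⇒gap≤ c e r t short = begin
    e                               ≤⟨ m+n≤o⇒m≤o∸n e (≤-trans (≤-reflexive (+-comm e (c * (n * t)))) (<⇒≤ short<)) ⟩
    c * (d * r) ∸ c * (n * t)       ≡⟨ *-distribˡ-∸ c (d * r) (n * t) ⟨
    c * (d * r ∸ n * t)             ≡⟨ cong (c *_) (trans (cong ∣_∣ (ℤ.m-n≡m⊖n (n * t) (d * r))) (ℤ.∣⊖∣-≤ nt≤dr)) ⟨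
    c * ∣ + (n * t) ℤ.- + (d * r) ∣ ∎
    where
    open ≤-Reasoning
    short< : c * (n * t) + e < c * (d * r)
    short< = <ᵇ⇒< _ _ short
    nt≤dr : n * t ≤ d * r
    nt≤dr = ≮⇒≥ (λ dr<nt → <⇒≱ short< (≤-trans (*-monoʳ-≤ c (<⇒≤ dr<nt)) (m≤m+n _ e)))

  -- Markov's inequality for the fourth moment.
  ∑-deficient*e^4≤ : ∀ c e r → ∑ (allVecs r n) (λ w → 𝟙 (deficient c e r (hits N r w))) * e ^ 4
                                ≤ c ^ 4 * (3 * r ^ 2 * n ^ r * n ^ 4)
  ∑-deficient*e^4≤ c e r = begin
    ∑ (allVecs r n) (λ w → 𝟙 (deficient c e r (hits N r w))) * e ^ 4 ≡⟨ ∑-*ʳ (allVecs r n) (e ^ 4) _ ⟨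
    ∑ (allVecs r n) (λ w → 𝟙 (deficient c e r (hits N r w)) * e ^ 4) ≤⟨ ∑-mono-≤ (allVecs r n) pointwise ⟩
    ∑ (allVecs r n) (λ w → c ^ 4 * ∣ deviation r w ∣ ^ 4)            ≡⟨ ∑-*ˡ (allVecs r n) (c ^ 4) _ ⟩
    c ^ 4 * M₄ r                                                     ≤⟨ *-monoʳ-≤ (c ^ 4) (M₄≤ r) ⟩
    c ^ 4 * (3 * r ^ 2 * n ^ r * n ^ 4)                              ∎
    where
    open ≤-Reasoning
    ^4-distrib : ∀ c x → (c * x) * ((c * x) * ((c * x) * ((c * x) * 1))) ≡ c * (c * (c * (c * 1))) * (x * (x * (x * (x * 1))))
    ^4-distrib = solve-∀
    pointwise : ∀ w → 𝟙 (deficient c e r (hits N r w)) * e ^ 4 ≤ c ^ 4 * ∣ deviation r w ∣ ^ 4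
    pointwise w with deficient c e r (hits N r w) in short
    ... | false = z≤n
    ... | true  = begin
      e ^ 4 + 0                          ≡⟨ +-identityʳ (e ^ 4) ⟩
      e ^ 4                              ≤⟨ ^-monoˡ-≤ 4 (deficient⇒gap≤ c e r (hits N r w) (subst T (sym short) _)) ⟩
      (c * ∣ deviation r w ∣) ^ 4        ≡⟨ ^4-distrib c ∣ deviation r w ∣ ⟩
      c ^ 4 * ∣ deviation r w ∣ ^ 4      ∎

  ∑-perms-deficient*e^4≤ : ∀ c e r → r ≤ n →
    ∑ (perms n) (λ π → 𝟙 (deficient c e r (count (λ j → chosen r π j ∧ N j)))) * e ^ 4
    ≤ falling (n ∸ r) (n ∸ r) * (c ^ 4 * (3 * r ^ 2 * n ^ r * n ^ 4))
  ∑-perms-deficient*e^4≤ c e r r≤n = begin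
    ∑ (perms n) (Φ ∘ meets) * e ^ 4                                ≡⟨ cong (_* e ^ 4) (∑-perms-invert n (Φ ∘ meets)) ⟨
    ∑ (perms n) (Φ ∘ meets ∘ invert) * e ^ 4                       ≡⟨ cong (_* e ^ 4) (∑-cong-∈ (perms n) (λ π π∈ →
                                                                        cong Φ (count-chosen-invert π (∈-perms⇒distinct π∈) N r))) ⟩
    ∑ (perms n) (Φ ∘ hits N r) * e ^ 4                             ≤⟨ *-monoˡ-≤ (e ^ 4) (∑-perms-hits≤ N Φ r r≤n) ⟩
    falling (n ∸ r) (n ∸ r) * ∑ (allVecs r n) (Φ ∘ hits N r) * e ^ 4 ≡⟨ *-assoc (falling (n ∸ r) (n ∸ r)) _ (e ^ 4) ⟩
    falling (n ∸ r) (n ∸ r) * (∑ (allVecs r n) (Φ ∘ hits N r) * e ^ 4) ≤⟨ *-monoʳ-≤ (falling (n ∸ r) (n ∸ r)) (∑-deficient*e^4≤ c e r) ⟩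
    falling (n ∸ r) (n ∸ r) * (c ^ 4 * (3 * r ^ 2 * n ^ r * n ^ 4)) ∎
    where
    open ≤-Reasoning
    Φ : ℕ → ℕ
    Φ = 𝟙 ∘ deficient c e r
    meets : Vec (Fin n) n → ℕ
    meets π = count (λ j → chosen r π j ∧ N j)

-- Minimum degrees of G[D₁]

minList-≤ : ∀ xs → All (minList xs ≤_) xs
minList-≤ []               = []
minList-≤ (x ∷ [])         = ≤-refl ∷ []
minList-≤ (x ∷ xs@(_ ∷ _)) = m⊓n≤m x (minList xs) ∷ All.map (≤-trans (m⊓n≤n x (minList xs))) (minList-≤ xs)

minList-satisfies : ∀ {P : ℕ → Set} xs → 0 < length xs → All P xs → P (minList xs)
minList-satisfies (x ∷ [])               _ (px ∷ _)   = px
minList-satisfies {P} (x ∷ xs@(_ ∷ _)) _ (px ∷ pxs) with ⊓-sel x (minList xs)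
... | inj₁ x⊓≡x = subst P (sym x⊓≡x) px
... | inj₂ x⊓≡m = subst P (sym x⊓≡m) (minList-satisfies xs (s≤s z≤n) pxs)

filterᵇ-true : ∀ {A : Set} (xs : List A) → filterᵇ (λ _ → true) xs ≡ xs
filterᵇ-true xs = filter-all (T? ∘ λ _ → true) (All.universal (λ _ → tt) xs)

δ₁-full≤ : ∀ {n} (G : BipGraph n) v → δ₁ G full ≤ count (G v)
δ₁-full≤ {n} G v = All.lookup (All.map⁻ (subst (λ xs → All (δ₁ G full ≤_) (map (λ i → count (G i)) xs))
                                                (filterᵇ-true (allFin n)) (minList-≤ _))) (∈-allFin v)

δ₂-full≤ : ∀ {n} (G : BipGraph n) u → δ₂ G full ≤ count (λ i → G i u)
δ₂-full≤ {n} G u = All.lookup (All.map⁻ (subst (λ xs → All (δ₂ G full ≤_) (map (λ j → count (λ i → G i j)) xs))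
                                                (filterᵇ-true (allFin n)) (minList-≤ _))) (∈-allFin u)

module _ {n r : ℕ} (r≤n : r ≤ n) {π : Vec (Fin n) n} (π-distinct : Distinct π) where

  minList-over-chosen : (f : Fin n → ℕ) {P : ℕ → Set} → 0 < r → (∀ i → T (chosen r π i) → P (f i)) →
                        P (minList (map f (filterᵇ (chosen r π) (allFin n))))
  minList-over-chosen f {P} 0<r P∘f = minList-satisfies {P} _ nonempty
    (All.map⁺ (All.map (λ {i} → P∘f i) (All.all-filter (T? ∘ chosen r π) (allFin n))))
    where
    nonempty : 0 < length (map f (filterᵇ (chosen r π) (allFin n)))
    nonempty = ≤-trans 0<r (≤-reflexive (trans (sym (count-chosen π π-distinct r r≤n))
                                               (sym (length-map f (filterᵇ (chosen r π) (allFin n))))))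

  ∑-chosen : ∀ R → ∑ (allFin n) (λ v → 𝟙 (chosen r π v) * R) ≡ r * R
  ∑-chosen R = trans (∑-*ʳ (allFin n) R (𝟙 ∘ chosen r π))
                     (cong (_* R) (trans (sym (count≡∑ (chosen r π))) (count-chosen π π-distinct r r≤n)))

¬deficient⇒ : ∀ {n} (N : Fin n → Bool) c e r t → WithReplacement.deficient N c e r t ≡ false →
              c * (count N * r) ≤ c * (n * t) + e
¬deficient⇒ N c e r t not-short = ≮⇒≥ (λ short → subst T not-short (<⇒<ᵇ short))

module Failures {n} (G : BipGraph n) (c e r : ℕ) (r≤n : r ≤ n) where

  open WithReplacement using (deficient)

  P : List (Vec (Fin n) n)
  P = perms n

  missesᵥ : Fin n → Vec (Fin n) n → Bool
  missesᵥ v π₂ = deficient (G v) c e r (count (λ j → chosen r π₂ j ∧ G v j))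

  missesᵤ : Fin n → Vec (Fin n) n → Bool
  missesᵤ u π₁ = deficient (λ i → G i u) c e r (count (λ i → chosen r π₁ i ∧ G i u))

  failures : Vec (Fin n) n → Vec (Fin n) n → ℕ
  failures π₁ π₂ = ∑ (allFin n) (λ v → 𝟙 (chosen r π₁ v) * 𝟙 (missesᵥ v π₂))
                 + ∑ (allFin n) (λ u → 𝟙 (chosen r π₂ u) * 𝟙 (missesᵤ u π₁))

  R : ℕ
  R = falling (n ∸ r) (n ∸ r) * (c ^ 4 * (3 * r ^ 2 * n ^ r * n ^ 4))

  -- Union bound over the r chosen vertices.
  ∑∑-chosen-misses*e^4≤ : (misses : Fin n → Vec (Fin n) n → Bool) → (∀ v → ∑ P (𝟙 ∘ misses v) * e ^ 4 ≤ R) →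
    ∑ P (λ π → ∑ P (λ σ → ∑ (allFin n) (λ v → 𝟙 (chosen r π v) * 𝟙 (misses v σ)))) * e ^ 4 ≤ length P * (r * R)
  ∑∑-chosen-misses*e^4≤ misses misses≤ = begin
    ∑ P (λ π → ∑ P (λ σ → ∑ (allFin n) (λ v → 𝟙 (chosen r π v) * 𝟙 (misses v σ)))) * e ^ 4
      ≡⟨ ∑-*ʳ P (e ^ 4) _ ⟨
    ∑ P (λ π → ∑ P (λ σ → ∑ (allFin n) (λ v → 𝟙 (chosen r π v) * 𝟙 (misses v σ))) * e ^ 4)
      ≡⟨ ∑-cong P factor ⟩
    ∑ P (λ π → ∑ (allFin n) (λ v → 𝟙 (chosen r π v) * (∑ P (𝟙 ∘ misses v) * e ^ 4)))
      ≤⟨ ∑-mono-≤ P (λ π → ∑-mono-≤ (allFin n) (λ v → *-monoʳ-≤ (𝟙 (chosen r π v)) (misses≤ v))) ⟩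
    ∑ P (λ π → ∑ (allFin n) (λ v → 𝟙 (chosen r π v) * R))
      ≡⟨ ∑-cong-∈ P (λ π π∈P → ∑-chosen r≤n (∈-perms⇒distinct π∈P) R) ⟩
    ∑ P (λ _ → r * R)
      ≡⟨ ∑-const P (r * R) ⟩
    length P * (r * R) ∎
    where
    open ≤-Reasoning
    factor : ∀ π → ∑ P (λ σ → ∑ (allFin n) (λ v → 𝟙 (chosen r π v) * 𝟙 (misses v σ))) * e ^ 4
                 ≡ ∑ (allFin n) (λ v → 𝟙 (chosen r π v) * (∑ P (𝟙 ∘ misses v) * e ^ 4))
    factor π = begin-equality
      ∑ P (λ σ → ∑ (allFin n) (λ v → 𝟙 (chosen r π v) * 𝟙 (misses v σ))) * e ^ 4
        ≡⟨ cong (_* e ^ 4) (∑-swap P (allFin n) _) ⟩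
      ∑ (allFin n) (λ v → ∑ P (λ σ → 𝟙 (chosen r π v) * 𝟙 (misses v σ))) * e ^ 4
        ≡⟨ cong (_* e ^ 4) (∑-cong (allFin n) (λ v → ∑-*ˡ P (𝟙 (chosen r π v)) (𝟙 ∘ misses v))) ⟩
      ∑ (allFin n) (λ v → 𝟙 (chosen r π v) * ∑ P (𝟙 ∘ misses v)) * e ^ 4
        ≡⟨ ∑-*ʳ (allFin n) (e ^ 4) _ ⟨
      ∑ (allFin n) (λ v → 𝟙 (chosen r π v) * ∑ P (𝟙 ∘ misses v) * e ^ 4)
        ≡⟨ ∑-cong (allFin n) (λ v → *-assoc (𝟙 (chosen r π v)) _ (e ^ 4)) ⟩
      ∑ (allFin n) (λ v → 𝟙 (chosen r π v) * (∑ P (𝟙 ∘ misses v) * e ^ 4)) ∎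

  ∑∑-failures*e^4≤ : ∑ P (λ π₁ → ∑ P (failures π₁)) * e ^ 4 ≤ length P * (r * R) + length P * (r * R)
  ∑∑-failures*e^4≤ = begin
    ∑ P (λ π₁ → ∑ P (failures π₁)) * e ^ 4
      ≡⟨ cong (_* e ^ 4) (trans (∑-cong P (λ π₁ → ∑-+ P _ _)) (∑-+ P _ _)) ⟩
    (Fᵥ + ∑ P (λ π₁ → ∑ P (λ π₂ → Σᵤ π₂ π₁))) * e ^ 4
      ≡⟨ cong (λ s → (Fᵥ + s) * e ^ 4) (∑-swap P P (λ π₁ π₂ → Σᵤ π₂ π₁)) ⟩
    (Fᵥ + ∑ P (λ π₂ → ∑ P (λ π₁ → Σᵤ π₂ π₁))) * e ^ 4
      ≡⟨ *-distribʳ-+ (e ^ 4) Fᵥ _ ⟩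
    Fᵥ * e ^ 4 + ∑ P (λ π₂ → ∑ P (λ π₁ → Σᵤ π₂ π₁)) * e ^ 4
      ≤⟨ +-mono-≤ (∑∑-chosen-misses*e^4≤ missesᵥ (λ v → WithReplacement.∑-perms-deficient*e^4≤ (G v) c e r r≤n))
                  (∑∑-chosen-misses*e^4≤ missesᵤ (λ u → WithReplacement.∑-perms-deficient*e^4≤ (λ i → G i u) c e r r≤n)) ⟩
    length P * (r * R) + length P * (r * R) ∎
    where
    open ≤-Reasoning
    Σᵤ : Vec (Fin n) n → Vec (Fin n) n → ℕ
    Σᵤ π₂ π₁ = ∑ (allFin n) (λ u → 𝟙 (chosen r π₂ u) * 𝟙 (missesᵤ u π₁))
    Fᵥ = ∑ P (λ π₁ → ∑ P (λ π₂ → ∑ (allFin n) (λ v → 𝟙 (chosen r π₁ v) * 𝟙 (missesᵥ v π₂))))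

  private
    second-false : ∀ {a b} → T a → 𝟙 a * 𝟙 b ≡ 0 → b ≡ false
    second-false {true} {false} _ _ = refl

  module _ (π₁ π₂ : Vec (Fin n) n) (no-failure : failures π₁ π₂ ≡ 0) (0<r : 0 < r) where

    δ₁-D₁-≥ : Distinct π₁ → c * (δ₁ G full * r) ≤ c * (n * δ₁ G (D₁ r π₁ π₂)) + e
    δ₁-D₁-≥ π₁-distinct = minList-over-chosen r≤n π₁-distinct (λ v → count (λ j → chosen r π₂ j ∧ G v j))
                            {λ t → c * (δ₁ G full * r) ≤ c * (n * t) + e} 0<r λ v chosen-v →
      ≤-trans (*-monoʳ-≤ c (*-monoˡ-≤ r (δ₁-full≤ G v)))
              (¬deficient⇒ (G v) c e r _ (second-false chosen-v
                (∑≡0⇒≡0 (allFin n) _ (m+n≡0⇒m≡0 _ no-failure) (∈-allFin v))))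

    δ₂-D₁-≥ : Distinct π₂ → c * (δ₂ G full * r) ≤ c * (n * δ₂ G (D₁ r π₁ π₂)) + e
    δ₂-D₁-≥ π₂-distinct = minList-over-chosen r≤n π₂-distinct (λ u → count (λ i → chosen r π₁ i ∧ G i u))
                            {λ t → c * (δ₂ G full * r) ≤ c * (n * t) + e} 0<r λ u chosen-u →
      ≤-trans (*-monoʳ-≤ c (*-monoˡ-≤ r (δ₂-full≤ G u)))
              (¬deficient⇒ (λ i → G i u) c e r _ (second-false chosen-u
                (∑≡0⇒≡0 (allFin n) _ (m+n≡0⇒n≡0 _ no-failure) (∈-allFin u))))

module ScaledInequalities where

  open import Data.Integer using (+_)

  toℚᵘ-ℕ→ℚ : ∀ k → toℚᵘ (ℕ→ℚ k) ≡ mkℚᵘ (+ k) 0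
  toℚᵘ-ℕ→ℚ k = cong toℚᵘ (ℚ.normalize-coprime {k} {0} (Coprime.sym (Coprime.1-coprimeTo k)))

  private
    pos-*-+ : ∀ a b c → + a ℤ.* (+ b ℤ.+ + c) ≡ + (a * (b + c))
    pos-*-+ a b c = trans (cong (+ a ℤ.*_) (sym (ℤ.pos-+ b c))) (sym (ℤ.pos-* a (b + c)))

  1+ε-≤⇒ : ∀ p q-1 .(cop : Coprime p (suc q-1)) n m →
           (ℚ.1ℚ ℚ.+ mkℚ (+ p) q-1 cop) ℚ.* ℕ→ℚ n ℚ.≤ ℕ→ℚ m → (suc q-1 + p) * n ≤ suc q-1 * m
  1+ε-≤⇒ p q-1 cop n m le = ℤ.drop‿+≤+ (subst₂ ℤ._≤_ lhs rhs (cross (ℚᵘ.≤-respʳ-≃ (ℚᵘ.≃-reflexive (toℚᵘ-ℕ→ℚ m))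
                                                          (ℚᵘ.≤-respˡ-≃ homo (ℚ.toℚᵘ-mono-≤ le)))))
    where
    q = suc q-1
    ε = mkℚ (+ p) q-1 cop
    homo : toℚᵘ ((ℚ.1ℚ ℚ.+ mkℚ (+ p) q-1 cop) ℚ.* ℕ→ℚ n) ℚᵘ.≃ (mkℚᵘ (+ 1) 0 ℚᵘ.+ mkℚᵘ (+ p) q-1) ℚᵘ.* mkℚᵘ (+ n) 0
    homo = ℚᵘ.≃-trans (ℚ.toℚᵘ-homo-* (ℚ.1ℚ ℚ.+ ε) (ℕ→ℚ n)) (ℚᵘ.*-cong (ℚ.toℚᵘ-homo-+ ℚ.1ℚ ε) (ℚᵘ.≃-reflexive (toℚᵘ-ℕ→ℚ n)))
    cross : ∀ {a b} → a ℚᵘ.≤ b → ℚᵘ.numerator a ℤ.* ℚᵘ.denominator b ℤ.≤ ℚᵘ.numerator b ℤ.* ℚᵘ.denominator a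
    cross (*≤* le) = le
    lhs : ((+ 1 ℤ.* + q ℤ.+ + p ℤ.* + 1) ℤ.* + n) ℤ.* + 1 ≡ + ((q + p) * n)
    lhs = trans (regroup (+ q) (+ p) (+ n)) (trans (pos-*-+ n q p) (cong +_ (*-comm n (q + p))))
      where
      regroup : ∀ q p n → ((+ 1 ℤ.* q ℤ.+ p ℤ.* + 1) ℤ.* n) ℤ.* + 1 ≡ n ℤ.* (q ℤ.+ p)
      regroup = ℤ.solve-∀
    rhs : + m ℤ.* + ((1 * q) * 1) ≡ + (q * m)
    rhs = trans (sym (ℤ.pos-* m _)) (cong +_ (trans (cong (m *_) (trans (*-identityʳ (1 * q)) (*-identityˡ q))) (*-comm m q)))

  ⇒1+ε/2-≤ : ∀ p q-1 .(cop : Coprime p (suc q-1)) s t → (2 * suc q-1 + p) * s ≤ t * (4 * suc q-1) →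
             (ℚ.1ℚ ℚ.+ mkℚ (+ p) q-1 cop ℚ.* ℚ.½) ℚ.* (ℕ→ℚ s ℚ.* ℚ.½) ℚ.≤ ℕ→ℚ t
  ⇒1+ε/2-≤ p q-1 cop s t le = ℚ.toℚᵘ-cancel-≤ (ℚᵘ.≤-respʳ-≃ (ℚᵘ.≃-sym (ℚᵘ.≃-reflexive (toℚᵘ-ℕ→ℚ t)))
                                               (ℚᵘ.≤-respˡ-≃ (ℚᵘ.≃-sym homo) (*≤* (subst₂ ℤ._≤_ (sym lhs) (sym rhs) (ℤ.+≤+ le)))))
    where
    q = suc q-1
    ε = mkℚ (+ p) q-1 cop
    ½ᵘ = mkℚᵘ (+ 1) 1
    homo : toℚᵘ ((ℚ.1ℚ ℚ.+ mkℚ (+ p) q-1 cop ℚ.* ℚ.½) ℚ.* (ℕ→ℚ s ℚ.* ℚ.½))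
           ℚᵘ.≃ (mkℚᵘ (+ 1) 0 ℚᵘ.+ mkℚᵘ (+ p) q-1 ℚᵘ.* ½ᵘ) ℚᵘ.* (mkℚᵘ (+ s) 0 ℚᵘ.* ½ᵘ)
    homo = ℚᵘ.≃-trans (ℚ.toℚᵘ-homo-* (ℚ.1ℚ ℚ.+ ε ℚ.* ℚ.½) (ℕ→ℚ s ℚ.* ℚ.½))
             (ℚᵘ.*-cong (ℚᵘ.≃-trans (ℚ.toℚᵘ-homo-+ ℚ.1ℚ (ε ℚ.* ℚ.½)) (ℚᵘ.+-cong (ℚᵘ.≃-refl {mkℚᵘ (+ 1) 0}) (ℚ.toℚᵘ-homo-* ε ℚ.½)))
                        (ℚᵘ.≃-trans (ℚ.toℚᵘ-homo-* (ℕ→ℚ s) ℚ.½) (ℚᵘ.*-cong (ℚᵘ.≃-reflexive (toℚᵘ-ℕ→ℚ s)) (ℚᵘ.≃-refl {½ᵘ}))))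
    lhs : (+ 1 ℤ.* (+ q ℤ.* + 2) ℤ.+ (+ p ℤ.* + 1) ℤ.* + 1) ℤ.* (+ s ℤ.* + 1) ℤ.* + 1 ≡ + ((2 * q + p) * s)
    lhs = trans (regroup (+ q) (+ p) (+ s))
            (trans (cong (λ z → + s ℤ.* (z ℤ.+ + p)) (sym (ℤ.pos-* 2 q))) (trans (pos-*-+ s (2 * q) p) (cong +_ (*-comm s _))))
      where
      regroup : ∀ q p s → (+ 1 ℤ.* (q ℤ.* + 2) ℤ.+ (p ℤ.* + 1) ℤ.* + 1) ℤ.* (s ℤ.* + 1) ℤ.* + 1 ≡ s ℤ.* (+ 2 ℤ.* q ℤ.+ p)
      regroup = ℤ.solve-∀
    rhs : + t ℤ.* + ((1 * (q * 2)) * (1 * 2)) ≡ + (t * (4 * q))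
    rhs = trans (sym (ℤ.pos-* t _)) (cong (λ z → + (t * z)) (four q))
      where
      four : ∀ q → (1 * (q * 2)) * (1 * 2) ≡ 4 * q
      four = solve-∀

open ScaledInequalities

-- The counting argument

-- With ε = p/q, c = 4q and e = prn, a vertex may fall short of its mean by e/(cn) = εr/4. ε enters only through
-- ε-scaled, which keeps rational arithmetic out of the counting.
module Concentration {n} (G : BipGraph n) (p q : ℕ) (ε : ℚ)
  (ε-scaled : ∀ s t → (2 * q + p) * s ≤ t * (4 * q) → (ℚ.1ℚ ℚ.+ ε ℚ.* ℚ.½) ℚ.* (ℕ→ℚ s ℚ.* ℚ.½) ℚ.≤ ℕ→ℚ t)
  (r : ℕ) (0<r : 0 < r) (r≤n : r ≤ n) (hyp : (q + p) * n ≤ q * (δ₁ G full + δ₂ G full)) where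

  e : ℕ
  e = p * r * n

  open Failures G (4 * q) e r r≤n

  no-failures⇒good : ∀ {π₁ π₂} → Distinct π₁ → Distinct π₂ → failures π₁ π₂ ≡ 0 → Good G ε r (π₁ , π₂)
  no-failures⇒good {π₁} {π₂} π₁-distinct π₂-distinct no-failure =
    ε-scaled (size D) t (subst (λ s → (2 * q + p) * s ≤ t * (4 * q)) (sym size-D) scaled)
    where
    D = D₁ r π₁ π₂
    t = δ₁ G D + δ₂ G D
    a = δ₁ G full
    b = δ₂ G full
    size-D : size D ≡ r + r
    size-D = cong₂ _+_ (count-chosen π₁ π₁-distinct r r≤n) (count-chosen π₂ π₂-distinct r r≤n)
    scaled : (2 * q + p) * (r + r) ≤ t * (4 * q)
    scaled = *-cancelʳ-≤ _ _ n {{>-nonZero (≤-trans 0<r r≤n)}} (+-cancelʳ-≤ (2 * e) _ _ (begin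
      (2 * q + p) * (r + r) * n + 2 * e               ≡⟨ lhs q p r n ⟩
      4 * r * ((q + p) * n)                           ≤⟨ *-monoʳ-≤ (4 * r) hyp ⟩
      4 * r * (q * (a + b))                           ≡⟨ middle q r a b ⟩
      4 * q * (a * r) + 4 * q * (b * r)               ≤⟨ +-mono-≤ (δ₁-D₁-≥ π₁ π₂ no-failure 0<r π₁-distinct) (δ₂-D₁-≥ π₁ π₂ no-failure 0<r π₂-distinct) ⟩
      4 * q * (n * δ₁ G D) + e + (4 * q * (n * δ₂ G D) + e) ≡⟨ rhs q n (δ₁ G D) (δ₂ G D) e ⟩
      t * (4 * q) * n + 2 * e                         ∎))
      where
      open ≤-Reasoning
      lhs : ∀ q p r n → (2 * q + p) * (r + r) * n + 2 * (p * r * n) ≡ 4 * r * ((q + p) * n)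
      lhs = solve-∀
      middle : ∀ q r a b → 4 * r * (q * (a + b)) ≡ 4 * q * (a * r) + 4 * q * (b * r)
      middle = solve-∀
      rhs : ∀ q n x y e → 4 * q * (n * x) + e + (4 * q * (n * y) + e) ≡ (x + y) * (4 * q) * n + 2 * e
      rhs = solve-∀

  goodCount≡∑∑ : goodCount G ε r ≡ ∑ P (λ π₁ → ∑ P (λ π₂ → 𝟙 (does (good? G ε r (π₁ , π₂)))))
  goodCount≡∑∑ = trans (length-filter (good? G ε r) (cartesianProduct P P))
                       (∑-cartesianProduct P P (λ π → 𝟙 (does (good? G ε r π))))

  good-or-failure : ∀ π₁ π₂ → Distinct π₁ → Distinct π₂ → 1 ≤ 𝟙 (does (good? G ε r (π₁ , π₂))) + failures π₁ π₂
  good-or-failure π₁ π₂ π₁-distinct π₂-distinct = by-cases (good? G ε r (π₁ , π₂)) (failures π₁ π₂) refl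
    where
    by-cases : (good : Dec (Good G ε r (π₁ , π₂))) (k : ℕ) → failures π₁ π₂ ≡ k → 1 ≤ 𝟙 (does good) + k
    by-cases (yes _)  _       _           = s≤s z≤n
    by-cases (no _)   (suc _) _           = s≤s z≤n
    by-cases (no bad) zero    no-failure = ⊥-elim (bad (no-failures⇒good π₁-distinct π₂-distinct no-failure))

  P²≤goodCount+failures : length P * length P ≤ goodCount G ε r + ∑ P (λ π₁ → ∑ P (failures π₁))
  P²≤goodCount+failures = begin
    length P * length P                                              ≡⟨ ∑-const P (length P) ⟨
    ∑ P (λ _ → length P)                                             ≡⟨ ∑-cong P (λ _ → length≡∑1 P) ⟩
    ∑ P (λ _ → ∑ P (λ _ → 1))                                        ≤⟨ ∑-mono-≤-∈ P (λ π₁ π₁∈ → ∑-mono-≤-∈ P (λ π₂ π₂∈ →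
                                                                          good-or-failure π₁ π₂ (∈-perms⇒distinct π₁∈) (∈-perms⇒distinct π₂∈))) ⟩
    ∑ P (λ π₁ → ∑ P (λ π₂ → 𝟙 (does (good? G ε r (π₁ , π₂))) + failures π₁ π₂))
      ≡⟨ trans (∑-cong P (λ π₁ → ∑-+ P _ (failures π₁))) (∑-+ P _ _) ⟩
    ∑ P (λ π₁ → ∑ P (λ π₂ → 𝟙 (does (good? G ε r (π₁ , π₂))))) + ∑ P (λ π₁ → ∑ P (failures π₁))
      ≡⟨ cong (_+ ∑ P (λ π₁ → ∑ P (failures π₁))) goodCount≡∑∑ ⟨
    goodCount G ε r + ∑ P (λ π₁ → ∑ P (failures π₁)) ∎
    where open ≤-Reasoning

  module _ (0<p : 0 < p) (1200c⁴≤r : 1200 * (4 * q) ^ 4 ≤ r) (2r²≤n : 2 * (r * r) ≤ n) where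

    private
      Fᵣ F′ : ℕ
      Fᵣ = falling n r
      F′ = falling (n ∸ r) (n ∸ r)

      length-P : length P ≡ Fᵣ * F′
      length-P = trans (length-perms n) (trans (cong (falling n) (sym (m+[n∸m]≡n r≤n))) (falling-+ n r (n ∸ r)))

      instance
        e≢0 : NonZero (e ^ 4)
        e≢0 = m^n≢0 e 4 {{>-nonZero (*-mono-< (*-mono-< 0<p 0<r) (≤-trans 0<r r≤n))}}

    200rR≤P*e^4 : 200 * (r * R) ≤ length P * e ^ 4
    200rR≤P*e^4 = begin
      200 * (r * (F′ * ((4 * q) ^ 4 * (3 * r ^ 2 * n ^ r * n ^ 4)))) ≡⟨ regroup r F′ ((4 * q) ^ 4) (n ^ r) n ⟩
      600 * (4 * q) ^ 4 * n ^ r * Z                            ≤⟨ *-monoˡ-≤ Z (*-monoʳ-≤ (600 * (4 * q) ^ 4) (^≤2*falling n r 2r²≤n)) ⟩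
      600 * (4 * q) ^ 4 * (2 * Fᵣ) * Z                          ≡⟨ double ((4 * q) ^ 4) Fᵣ Z ⟩
      1200 * (4 * q) ^ 4 * (Fᵣ * Z)                             ≤⟨ *-monoˡ-≤ (Fᵣ * Z) (≤-trans 1200c⁴≤r (m≤n*m r (p ^ 4) {{m^n≢0 p 4 {{>-nonZero 0<p}}}})) ⟩
      p ^ 4 * r * (Fᵣ * Z)                                      ≡⟨ collect p r n Fᵣ F′ ⟩
      Fᵣ * F′ * e ^ 4                                           ≡⟨ cong (_* e ^ 4) length-P ⟨
      length P * e ^ 4                                          ∎
      where
      open ≤-Reasoning
      Z = F′ * (r * r * r) * n ^ 4
      regroup : ∀ r F′ c⁴ nʳ n → 200 * (r * (F′ * (c⁴ * (3 * (r * (r * 1)) * nʳ * (n * (n * (n * (n * 1))))))))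
                                ≡ 600 * c⁴ * nʳ * (F′ * (r * r * r) * (n * (n * (n * (n * 1)))))
      regroup = solve-∀
      double : ∀ c⁴ Fᵣ Z → 600 * c⁴ * (2 * Fᵣ) * Z ≡ 1200 * c⁴ * (Fᵣ * Z)
      double = solve-∀
      collect : ∀ p r n Fᵣ F′ → p * (p * (p * (p * 1))) * r * (Fᵣ * (F′ * (r * r * r) * (n * (n * (n * (n * 1))))))
                                ≡ Fᵣ * F′ * ((p * r * n) * ((p * r * n) * ((p * r * n) * ((p * r * n) * 1))))
      collect = solve-∀

    100*failures≤P² : 100 * ∑ P (λ π₁ → ∑ P (failures π₁)) ≤ length P * length P
    100*failures≤P² = *-cancelʳ-≤ _ _ (e ^ 4) (begin
      100 * B * e ^ 4                                  ≡⟨ *-assoc 100 B (e ^ 4) ⟩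
      100 * (B * e ^ 4)                                ≤⟨ *-monoʳ-≤ 100 ∑∑-failures*e^4≤ ⟩
      100 * (length P * (r * R) + length P * (r * R))  ≡⟨ regroup (length P) (r * R) ⟩
      length P * (200 * (r * R))                       ≤⟨ *-monoʳ-≤ (length P) 200rR≤P*e^4 ⟩
      length P * (length P * e ^ 4)                    ≡⟨ *-assoc (length P) (length P) (e ^ 4) ⟨
      length P * length P * e ^ 4                      ∎)
      where
      open ≤-Reasoning
      B = ∑ P (λ π₁ → ∑ P (failures π₁))
      regroup : ∀ L y → 100 * (L * y + L * y) ≡ L * (200 * y)
      regroup = solve-∀

    99*P²≤100*goodCount : 99 * (length (perms n) * length (perms n)) ≤ 100 * goodCount G ε r
    99*P²≤100*goodCount = +-cancelʳ-≤ X (99 * X) (100 * goodCount G ε r) (begin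
      99 * X + X                                        ≡⟨ +-comm (99 * X) X ⟩
      100 * X                                           ≤⟨ *-monoʳ-≤ 100 P²≤goodCount+failures ⟩
      100 * (goodCount G ε r + B)                       ≡⟨ *-distribˡ-+ 100 (goodCount G ε r) B ⟩
      100 * goodCount G ε r + 100 * B                   ≤⟨ +-monoʳ-≤ (100 * goodCount G ε r) 100*failures≤P² ⟩
      100 * goodCount G ε r + X                         ∎)
      where
      open ≤-Reasoning
      X = length P * length P
      B = ∑ P (λ π₁ → ∑ P (failures π₁))

rVal-bounds : ∀ C n → 2 ≤ C → C ≤ rVal C n × rVal C n ≤ 2 * ((C ∸ 1) * C)
rVal-bounds C@(suc (suc c)) n (s≤s (s≤s z≤n)) =
  ≤-trans (m≤n*m C (suc c)) (m≤m+n m (n % m)) , +-monoʳ-≤ m (≤-trans (<⇒≤ (m%n<n n m)) (m≤m+n m 0))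
  where
  m = suc c * C

-- r ≤ 2(C-1)C, so n ≥ n₀ C forces 2r² ≤ n.
n₀ : ℕ → ℕ
n₀ C = suc (2 * (2 * ((C ∸ 1) * C) * (2 * ((C ∸ 1) * C))))

module _ {C n : ℕ} (2≤C : 2 ≤ C) (n₀≤n : n₀ C ≤ n) where

  0<rVal : 0 < rVal C n
  0<rVal = ≤-trans (s≤s z≤n) (≤-trans 2≤C (proj₁ (rVal-bounds C n 2≤C)))

  2rVal²≤n : 2 * (rVal C n * rVal C n) ≤ n
  2rVal²≤n = ≤-trans (*-monoʳ-≤ 2 (*-mono-≤ r≤2m r≤2m)) (≤-trans (n≤1+n _) n₀≤n)
    where r≤2m = proj₂ (rVal-bounds C n 2≤C)

  rVal≤n : rVal C n ≤ n
  rVal≤n = ≤-trans (≤-trans (r≤r*r (rVal C n)) (m≤n*m (rVal C n * rVal C n) 2)) 2rVal²≤n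

concentration-for : ∀ p-1 q-1 .(cop : Coprime (suc p-1) (suc q-1)) C → 2 + 1200 * (4 * suc q-1) ^ 4 ≤ C →
  ∀ n → n₀ C ≤ n → (G : BipGraph n) →
  (ℚ.1ℚ ℚ.+ mkℚ ℤ.+[1+ p-1 ] q-1 cop) ℚ.* ℕ→ℚ n ℚ.≤ ℕ→ℚ (δ₁ G full + δ₂ G full) →
  99 * (length (perms n) * length (perms n)) ≤ 100 * goodCount G (mkℚ ℤ.+[1+ p-1 ] q-1 cop) (rVal C n)
concentration-for p-1 q-1 cop C C₀≤C n n₀≤n G hyp =
  Concentration.99*P²≤100*goodCount G (suc p-1) (suc q-1) (mkℚ ℤ.+[1+ p-1 ] q-1 cop) (⇒1+ε/2-≤ (suc p-1) q-1 cop)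
    (rVal C n) (0<rVal 2≤C n₀≤n) (rVal≤n 2≤C n₀≤n) (1+ε-≤⇒ (suc p-1) q-1 cop n _ hyp)
    (s≤s z≤n) (≤-trans (m+n≤o⇒n≤o 2 C₀≤C) (proj₁ (rVal-bounds C n 2≤C))) (2rVal²≤n 2≤C n₀≤n)
  where
  2≤C : 2 ≤ C
  2≤C = m+n≤o⇒m≤o 2 C₀≤C

lemma4p11 : (ε : ℚ) → ℚ.0ℚ ℚ.< ε →
    Σ ℕ (λ C₀ → (C : ℕ) → C₀ ≤ C →
      Σ ℕ (λ n₀ → (n : ℕ) → n₀ ≤ n →
        (G : BipGraph n) →
        (ℚ.1ℚ ℚ.+ ε) ℚ.* ℕ→ℚ n ℚ.≤ ℕ→ℚ (δ₁ G full + δ₂ G full) →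
        99 * (length (perms n) * length (perms n)) ≤ 100 * goodCount G ε (rVal C n)))
lemma4p11 (mkℚ (ℤ.+ zero) _ _)      (ℚ.*<* (ℤ.+<+ ()))
lemma4p11 (mkℚ ℤ.-[1+ _ ] _ _)      (ℚ.*<* ())
lemma4p11 (mkℚ ℤ.+[1+ p-1 ] q-1 cop) _ =
  2 + 1200 * (4 * suc q-1) ^ 4 , λ C C₀≤C → n₀ C , concentration-for p-1 q-1 cop C C₀≤C
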